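{- For all integers $m\geq 1$, $n\geq 1$ and $k\geq 1$, the modified complete bipartite graph $M^kK_{m,n}$ satisfies $$t(M^k K_{m,n})=k\, n^{m-1}(m+k-1)^{n-1}.$$
   Context: Graphs may have multiple edges; $t(G)$ denotes the number of spanning trees of $G$, with parallel edges distinguished. Let $K_{m,n}$ be the complete bipartite graph with vertex set $V_1\cup V_2$, where $V_1=\{p_1,\ldots,p_n\}$ and $V_2=\{q_1,\ldots,q_m\}$, each $q_j$ joined to each $p_i$ by one edge. The graph $M^kK_{m,n}$ is obtained from $K_{m,n}$ by replacing each edge between $q_m$ and $p_i$ ($i=1,\ldots,n$) by $k$ parallel edges; all other edges stay single. -}

module Defs where

open import Data.Nat using (ℕ; zero; suc; _+_; _*_; _∸_; _^_; _≡ᵇ_)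
open import Data.Bool using (Bool; true; false; _∧_; _∨_; not; if_then_else_)
open import Data.Fin using (Fin; toℕ; _↑ˡ_; _↑ʳ_)
open import Data.List using (List; []; _∷_; _++_; map; concatMap; length; filter; replicate; allFin)
open import Data.Vec using (Vec; lookup; replicate; _[_]≔_)
open import Data.Product using (_×_; _,_)
open import Relation.Nullary.Decidable using (yes; no)
open import Data.Bool.Properties using (T?)

all : {A : Set} → (A → Bool) → List A → Bool
all p [] = true
all p (x ∷ xs) = p x ∧ all p xs

-- A multigraph on the vertex set Fin V is a list of edges (pairs of endpoints).
-- Parallel edges are distinct list entries, so they are distinguished.
Multigraph : ℕ → Set
Multigraph V = List (Fin V × Fin V)

-- All sub-multisets of the edge list, chosen by position (each choice of
-- positions counted once, so parallel edges are distinguished).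
sublists : {A : Set} → List A → List (List A)
sublists [] = [] ∷ []
sublists (x ∷ xs) = let r = sublists xs in map (x ∷_) r ++ r

picks : {A : Set} → List A → List (A × List A)
picks [] = []
picks (x ∷ xs) = (x , xs) ∷ map (λ { (y , ys) → (y , x ∷ ys) }) (picks xs)

reachStep : {V : ℕ} → Multigraph V → Vec Bool V → Vec Bool V
reachStep [] R = R
reachStep ((u , v) ∷ es) R =
  let R' = reachStep es R in
  if lookup R u ∨ lookup R v then (R' [ u ]≔ true) [ v ]≔ true else R'

iterate : {A : Set} → ℕ → (A → A) → A → A
iterate zero f a = a
iterate (suc n) f a = iterate n f (f a)

-- set of vertices reachable from s using edges of es (V steps suffice)
reachable : {V : ℕ} → Multigraph V → Fin V → Vec Bool V
reachable {V} es s = iterate V (reachStep es) (Data.Vec.replicate V false [ s ]≔ true)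

connectsB : {V : ℕ} → Multigraph V → Fin V → Fin V → Bool
connectsB es u v = lookup (reachable es u) v

connectedB : {V : ℕ} → Multigraph V → Bool
connectedB {V} es = all (λ u → all (λ v → connectsB es u v) (allFin V)) (allFin V)

-- acyclic: no edge lies on a cycle, i.e. for each edge its endpoints are not
-- connected by the remaining edges (this also excludes loops)
acyclicB : {V : ℕ} → Multigraph V → Bool
acyclicB es = all (λ { ((u , v) , rest) → not (connectsB rest u v) }) (picks es)

isSpanningTreeB : {V : ℕ} → Multigraph V → Bool
isSpanningTreeB es = connectedB es ∧ acyclicB es

t : {V : ℕ} → Multigraph V → ℕ
t G = length (filter (λ S → T? (isSpanningTreeB S)) (sublists G))

-- M^k K_{m,n}: vertices p_i = inject+ m i (i < n), q_j = raise n j (j < m);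
-- edge q_j p_i has multiplicity k when j is the last index (q_m), else 1.
MkKmn : (m n k : ℕ) → Multigraph (n + m)
MkKmn m n k =
  concatMap (λ j → concatMap (λ i →
      Data.List.replicate (if suc (toℕ j) ≡ᵇ m then k else 1) (n ↑ʳ j , i ↑ˡ m))
    (allFin n)) (allFin m)

-- Spanning trees are counted edge by edge by deletion–contraction, remembering of the forest
-- chosen so far only the partition of the vertices into its components (`completions`).
-- The edges of M^k K_{m,n} come star by star, one q after the other, the k-fold star last.
-- After a star, if every q seen so far is joined to some p and the components contain
-- c₁, …, c_r of the p's, the number of completions by the s + 1 remaining stars is
--     k nˢ (s + k)^(r-1) c₁ ⋯ c_r,
-- which for the empty forest (r = n, all cᵢ = 1, s + 1 = m) is the claimed formula.  Within a
-- star the count is k nˢ times the ε-part of a product of dual numbers (ε² = 0): the component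
-- of the current q contributes 1 + c ε and every other component (s + k) c + ρ + ρ c ε, where ρ
-- counts its p's whose edge to q is still undecided; the terms ρ and ρ c ε join the component
-- to that of q, and ε picks a p of the final component of q.  In the last star the count is the
-- product of k ρ over the components other than that of q.  These closed forms satisfy the
-- deletion–contraction recursion edge by edge and agree where two stars meet.

module Submission where

open import Defs
open import Data.Nat using (ℕ; zero; suc; _+_; _*_; _^_; _≤_; _<_; _≥_; _∸_; _≡ᵇ_; z≤n; s≤s; s≤s⁻¹)
open import Data.Nat.Properties
  using (_<?_; ≤-refl; ≤-reflexive; ≤-trans; ≤-antisym; <-irrefl; ≤⇒≯; ≮⇒≥; ≤∧≢⇒<;
         n≮n; n≤1+n; m<n⇒m<1+n; m≤n⇒m≤1+n; m≤m+n;
         +-monoʳ-≤; +-monoʳ-<; n<1+n; +-suc; +-comm; +-assoc; +-identityʳ;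
         *-comm; *-assoc; *-identityʳ; *-zeroʳ; *-cancelˡ-≡;
         +-0-commutativeMonoid)
open import Data.Nat.Tactic.RingSolver using (solve-∀)
open import Algebra.Properties.CommutativeMonoid.Sum +-0-commutativeMonoid
  using (sum; sum-cong-≗; ∑-distrib-+; sum-replicate-zero)
open import Data.Bool using (Bool; true; false; _∧_; _∨_; not; if_then_else_)
open import Data.Bool.Properties
  using (T?; ∧-assoc; ∧-zeroʳ; ∧-identityʳ; ∧-conicalˡ; ∧-conicalʳ; ¬-not; not-injective)
open import Data.Fin using (Fin; zero; suc; toℕ; _↑ˡ_; _↑ʳ_; fromℕ<)
open import Data.Fin.Properties
  using (_≟_; toℕ-↑ˡ; toℕ-↑ʳ; toℕ<n; toℕ-injective; toℕ-fromℕ<; ↑ˡ-injective; any?)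
open import Data.List using (List; []; _∷_; _++_; map; length; filter; allFin; concatMap; replicate; drop; tabulate)
open import Data.List.Properties using (++-identityʳ; ++-assoc; length-map; length-tabulate; drop-all)
open import Data.List.Membership.Propositional using (_∈_)
open import Data.List.Membership.Propositional.Properties using (∈-map⁻; ∈-allFin)
open import Data.List.Relation.Unary.Any using (here; there)
open import Data.List.Relation.Binary.Subset.Propositional using (_⊆_)
open import Data.List.Relation.Binary.Permutation.Propositional as ↭ using (_↭_; ↭-sym)
open import Data.List.Relation.Binary.Permutation.Propositional.Properties using (∈-resp-↭; shift)
open import Data.Vec using (Vec; lookup; _[_]≔_; count) renaming ([] to []ᵛ; _∷_ to _∷ᵛ_)
open import Data.Vec.Properties using (lookup∘update; lookup∘update′; lookup-replicate; count≤n)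
open import Data.Product using (_×_; _,_; proj₁; proj₂; ∃)
open import Data.Sum using (_⊎_; inj₁; inj₂)
open import Data.Empty using (⊥-elim)
open import Function using (_∘_)
open import Relation.Nullary using (¬_; yes; no; Dec; does)
open import Relation.Nullary.Decidable using (dec-true; dec-false)
open import Relation.Binary.PropositionalEquality
  using (_≡_; _≢_; _≗_; refl; sym; trans; cong; cong₂; subst; module ≡-Reasoning)

private variable
  V : ℕ

Edge : ℕ → Set
Edge V = Fin V × Fin V

data Connected (G : Multigraph V) : Fin V → Fin V → Set where
  c-refl  : ∀ {u} → Connected G u u
  c-edge  : ∀ {u v} → (u , v) ∈ G → Connected G u v
  c-sym   : ∀ {u v} → Connected G u v → Connected G v u
  c-trans : ∀ {u v w} → Connected G u v → Connected G v w → Connected G u w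

Connected-mono : ∀ {G H : Multigraph V} {u v} → G ⊆ H → Connected G u v → Connected H u v
Connected-mono G⊆H c-refl        = c-refl
Connected-mono G⊆H (c-edge e)    = c-edge (G⊆H e)
Connected-mono G⊆H (c-sym c)     = c-sym (Connected-mono G⊆H c)
Connected-mono G⊆H (c-trans c d) = c-trans (Connected-mono G⊆H c) (Connected-mono G⊆H d)

Connected-[] : ∀ {u v : Fin V} → Connected [] u v → u ≡ v
Connected-[] c-refl        = refl
Connected-[] (c-sym c)     = sym (Connected-[] c)
Connected-[] (c-trans c d) = trans (Connected-[] c) (Connected-[] d)

true≢false : true ≢ false
true≢false ()

bool-ext : ∀ {a b : Bool} → (a ≡ true → b ≡ true) → (b ≡ true → a ≡ true) → a ≡ b
bool-ext {true}          f g = sym (f refl)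
bool-ext {false} {true}  f g = g refl
bool-ext {false} {false} f g = refl

-- Correctness of the reachability algorithm

_⊆ᵇ_ : Vec Bool V → Vec Bool V → Set
R ⊆ᵇ R′ = ∀ w → lookup R w ≡ true → lookup R′ w ≡ true

mark-⊆ᵇ : ∀ (R : Vec Bool V) a → R ⊆ᵇ (R [ a ]≔ true)
mark-⊆ᵇ R a w Rw with w ≟ a
... | yes refl = lookup∘update a R true
... | no w≢a   = trans (lookup∘update′ w≢a R true) Rw

mark⁻ : ∀ (R : Vec Bool V) a w → lookup (R [ a ]≔ true) w ≡ true → w ≡ a ⊎ lookup R w ≡ true
mark⁻ R a w h with w ≟ a
... | yes w≡a = inj₁ w≡a
... | no w≢a  = inj₂ (trans (sym (lookup∘update′ w≢a R true)) h)

mark-marked : ∀ (R : Vec Bool V) {a} → lookup R a ≡ true → lookup (R [ a ]≔ true) ≗ lookup R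
mark-marked R {a} Ra w with w ≟ a
... | yes refl = trans (lookup∘update a R true) (sym Ra)
... | no w≢a   = lookup∘update′ w≢a R true

mark₂-⊆ᵇ : ∀ (R : Vec Bool V) a b → R ⊆ᵇ ((R [ a ]≔ true) [ b ]≔ true)
mark₂-⊆ᵇ R a b w Rw = mark-⊆ᵇ (R [ a ]≔ true) b w (mark-⊆ᵇ R a w Rw)

mark₂-marks : ∀ (R : Vec Bool V) a b →
  lookup ((R [ a ]≔ true) [ b ]≔ true) a ≡ true × lookup ((R [ a ]≔ true) [ b ]≔ true) b ≡ true
mark₂-marks R a b = mark-⊆ᵇ (R [ a ]≔ true) b a (lookup∘update a R true) , lookup∘update b (R [ a ]≔ true) true

reachStep-⊆ᵇ : ∀ (G : Multigraph V) R → R ⊆ᵇ reachStep G R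
reachStep-⊆ᵇ []            R w Rw = Rw
reachStep-⊆ᵇ ((u , v) ∷ G) R w Rw with lookup R u ∨ lookup R v
... | true  = mark₂-⊆ᵇ (reachStep G R) u v w (reachStep-⊆ᵇ G R w Rw)
... | false = reachStep-⊆ᵇ G R w Rw

Reaches : Multigraph V → Fin V → Vec Bool V → Set
Reaches G s R = ∀ w → lookup R w ≡ true → Connected G s w

Reaches-mark₂ : ∀ {G : Multigraph V} {s} R {a b} → Reaches G s R → Connected G s a → Connected G s b →
  Reaches G s ((R [ a ]≔ true) [ b ]≔ true)
Reaches-mark₂ R {a} {b} reach sa sb w h with mark⁻ (R [ a ]≔ true) b w h
... | inj₁ refl = sb
... | inj₂ h′ with mark⁻ R a w h′
...   | inj₁ refl = sa
...   | inj₂ Rw   = reach w Rw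

reachStep-sound : ∀ {G H : Multigraph V} {s R} → H ⊆ G → Reaches G s R → Reaches G s (reachStep H R)
reachStep-sound {H = []} H⊆G reach = reach
reachStep-sound {H = (u , v) ∷ H} {R = R} H⊆G reach
  with rest ← reachStep-sound {H = H} (H⊆G ∘ there) reach | uv ← c-edge (H⊆G (here refl))
     | lookup R u in Ru | lookup R v in Rv
... | true  | _     = Reaches-mark₂ (reachStep H R) rest (reach u Ru) (c-trans (reach u Ru) uv)
... | false | true  = Reaches-mark₂ (reachStep H R) rest (c-trans (reach v Rv) (c-sym uv)) (reach v Rv)
... | false | false = rest

Closed : Multigraph V → Vec Bool V → Set
Closed G R = ∀ {u v} → (u , v) ∈ G → lookup R u ≡ lookup R v

reachStep-marks-edge : ∀ (G : Multigraph V) R {u v} → (u , v) ∈ G → lookup R u ≡ true ⊎ lookup R v ≡ true →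
  lookup (reachStep G R) u ≡ true × lookup (reachStep G R) v ≡ true
reachStep-marks-edge ((u , v) ∷ G) R (here refl) Ru∨Rv with lookup R u | lookup R v | Ru∨Rv
... | true  | _     | _      = mark₂-marks (reachStep G R) u v
... | false | true  | _      = mark₂-marks (reachStep G R) u v
... | false | false | inj₁ ()
... | false | false | inj₂ ()
reachStep-marks-edge ((a , b) ∷ G) R {u} {v} (there e) Ru∨Rv with lookup R a ∨ lookup R b
... | true  = let (Su , Sv) = reachStep-marks-edge G R e Ru∨Rv
              in mark₂-⊆ᵇ (reachStep G R) a b u Su , mark₂-⊆ᵇ (reachStep G R) a b v Sv
... | false = reachStep-marks-edge G R e Ru∨Rv

reachStep-fixed⇒Closed : ∀ (G : Multigraph V) R → lookup (reachStep G R) ≗ lookup R → Closed G R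
reachStep-fixed⇒Closed G R fixed e = bool-ext
  (λ Ru → trans (sym (fixed _)) (proj₂ (reachStep-marks-edge G R e (inj₁ Ru))))
  (λ Rv → trans (sym (fixed _)) (proj₁ (reachStep-marks-edge G R e (inj₂ Rv))))

Closed⇒reachStep-fixed : ∀ {G H : Multigraph V} R → H ⊆ G → Closed G R → lookup (reachStep H R) ≗ lookup R
Closed⇒reachStep-fixed {H = []} R H⊆G closed w = refl
Closed⇒reachStep-fixed {H = (a , b) ∷ H} R H⊆G closed w
  with lookup R a in Ra | lookup R b in Rb | closed (H⊆G (here refl))
... | true  | true  | _ = begin
    lookup ((S [ a ]≔ true) [ b ]≔ true) w ≡⟨ mark-marked (S [ a ]≔ true) (mark-⊆ᵇ S a b (trans (fixed b) Rb)) w ⟩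
    lookup (S [ a ]≔ true) w               ≡⟨ mark-marked S (trans (fixed a) Ra) w ⟩
    lookup S w                             ≡⟨ fixed w ⟩
    lookup R w                             ∎
  where
  open ≡-Reasoning
  S = reachStep H R
  fixed = Closed⇒reachStep-fixed R (H⊆G ∘ there) closed
... | false | false | _ = Closed⇒reachStep-fixed R (H⊆G ∘ there) closed w

trues : Vec Bool V → ℕ
trues = count T?

⊆ᵇ⇒trues≤ : ∀ (R R′ : Vec Bool V) → R ⊆ᵇ R′ → trues R ≤ trues R′
⊆ᵇ⇒trues≤ []ᵛ           []ᵛ            R⊆R′ = z≤n
⊆ᵇ⇒trues≤ (true  ∷ᵛ R) (true  ∷ᵛ R′) R⊆R′ = s≤s (⊆ᵇ⇒trues≤ R R′ (R⊆R′ ∘ suc))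
⊆ᵇ⇒trues≤ (true  ∷ᵛ R) (false ∷ᵛ R′) R⊆R′ with () ← R⊆R′ zero refl
⊆ᵇ⇒trues≤ (false ∷ᵛ R) (true  ∷ᵛ R′) R⊆R′ = m≤n⇒m≤1+n (⊆ᵇ⇒trues≤ R R′ (R⊆R′ ∘ suc))
⊆ᵇ⇒trues≤ (false ∷ᵛ R) (false ∷ᵛ R′) R⊆R′ = ⊆ᵇ⇒trues≤ R R′ (R⊆R′ ∘ suc)

⊆ᵇ⇒≗⊎trues< : ∀ (R R′ : Vec Bool V) → R ⊆ᵇ R′ → lookup R′ ≗ lookup R ⊎ suc (trues R) ≤ trues R′
⊆ᵇ⇒≗⊎trues< []ᵛ []ᵛ _ = inj₁ (λ ())
⊆ᵇ⇒≗⊎trues< (b ∷ᵛ R) (b′ ∷ᵛ R′) R⊆R′ with ⊆ᵇ⇒≗⊎trues< R R′ (R⊆R′ ∘ suc)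
⊆ᵇ⇒≗⊎trues< (true  ∷ᵛ R) (true  ∷ᵛ R′) R⊆R′ | inj₁ eq = inj₁ λ { zero → refl ; (suc w) → eq w }
⊆ᵇ⇒≗⊎trues< (true  ∷ᵛ R) (true  ∷ᵛ R′) R⊆R′ | inj₂ lt = inj₂ (s≤s lt)
⊆ᵇ⇒≗⊎trues< (true  ∷ᵛ R) (false ∷ᵛ R′) R⊆R′ | _ with () ← R⊆R′ zero refl
⊆ᵇ⇒≗⊎trues< (false ∷ᵛ R) (false ∷ᵛ R′) R⊆R′ | inj₁ eq = inj₁ λ { zero → refl ; (suc w) → eq w }
⊆ᵇ⇒≗⊎trues< (false ∷ᵛ R) (false ∷ᵛ R′) R⊆R′ | inj₂ lt = inj₂ lt
⊆ᵇ⇒≗⊎trues< (false ∷ᵛ R) (true  ∷ᵛ R′) R⊆R′ | _ = inj₂ (s≤s (⊆ᵇ⇒trues≤ R R′ (R⊆R′ ∘ suc)))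

source : Fin V → Vec Bool V
source {V} s = Data.Vec.replicate V false [ s ]≔ true

reachedIn : Multigraph V → Fin V → ℕ → Vec Bool V
reachedIn G s i = iterate i (reachStep G) (source s)

reachedIn-suc : ∀ (G : Multigraph V) s i → reachedIn G s (suc i) ≡ reachStep G (reachedIn G s i)
reachedIn-suc G s i = go i (source s)
  where
  go : ∀ i R → iterate (suc i) (reachStep G) R ≡ reachStep G (iterate i (reachStep G) R)
  go zero    R = refl
  go (suc i) R = go i (reachStep G R)

-- V rounds suffice: until the marked set is closed under the edges, every round marks a new vertex.
reachedIn-closed-or-grows : ∀ (G : Multigraph V) s i → Closed G (reachedIn G s i) ⊎ suc i ≤ trues (reachedIn G s i)
reachedIn-closed-or-grows {V} G s zero = inj₂ (source-trues s)
  where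
  source-trues : ∀ {V} (s : Fin V) → 1 ≤ trues (source s)
  source-trues zero    = s≤s z≤n
  source-trues (suc s) = source-trues s
reachedIn-closed-or-grows G s (suc i) rewrite reachedIn-suc G s i =
  round (reachedIn G s i) (reachedIn-closed-or-grows G s i)
  where
  round : ∀ R → Closed G R ⊎ suc i ≤ trues R → Closed G (reachStep G R) ⊎ suc (suc i) ≤ trues (reachStep G R)
  round R (inj₁ closed) = inj₁ λ e → trans (fixed _) (trans (closed e) (sym (fixed _)))
    where fixed = Closed⇒reachStep-fixed R (λ e → e) closed
  round R (inj₂ grown) with ⊆ᵇ⇒≗⊎trues< R (reachStep G R) (reachStep-⊆ᵇ G R)
  ... | inj₁ fixed = inj₁ λ e → trans (fixed _) (trans (reachStep-fixed⇒Closed G R fixed e) (sym (fixed _)))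
  ... | inj₂ more  = inj₂ (≤-trans (s≤s grown) more)

reachable-closed : ∀ (G : Multigraph V) s → Closed G (reachable G s)
reachable-closed {V} G s with reachedIn-closed-or-grows G s V
... | inj₁ closed = closed
... | inj₂ grown  = ⊥-elim (<-irrefl refl (≤-trans grown (count≤n T? (reachable G s))))

reachedIn-source : ∀ (G : Multigraph V) s i → lookup (reachedIn G s i) s ≡ true
reachedIn-source {V} G s zero = lookup∘update s (Data.Vec.replicate V false) true
reachedIn-source G s (suc i) rewrite reachedIn-suc G s i = reachStep-⊆ᵇ G _ s (reachedIn-source G s i)

reachedIn-sound : ∀ (G : Multigraph V) s i → Reaches G s (reachedIn G s i)
reachedIn-sound {V} G s zero w h with mark⁻ (Data.Vec.replicate V false) s w h
... | inj₁ refl = c-refl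
... | inj₂ h′ with () ← trans (sym (lookup-replicate w false)) h′
reachedIn-sound G s (suc i) rewrite reachedIn-suc G s i = reachStep-sound (λ e → e) (reachedIn-sound G s i)

Closed-resp-Connected : ∀ {G : Multigraph V} R → Closed G R → ∀ {a b} → Connected G a b → lookup R a ≡ lookup R b
Closed-resp-Connected R closed c-refl        = refl
Closed-resp-Connected R closed (c-edge e)    = closed e
Closed-resp-Connected R closed (c-sym c)     = sym (Closed-resp-Connected R closed c)
Closed-resp-Connected R closed (c-trans c d) =
  trans (Closed-resp-Connected R closed c) (Closed-resp-Connected R closed d)

connectsB-complete : ∀ (G : Multigraph V) {u v} → Connected G u v → connectsB G u v ≡ true
connectsB-complete {V} G {u} c =
  trans (sym (Closed-resp-Connected (reachable G u) (reachable-closed G u) c)) (reachedIn-source G u V)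

connectsB-sound : ∀ (G : Multigraph V) {u v} → connectsB G u v ≡ true → Connected G u v
connectsB-sound {V} G {u} {v} = reachedIn-sound G u V v

connectsB-false : ∀ (G : Multigraph V) {u v} → connectsB G u v ≡ false → ¬ Connected G u v
connectsB-false G h c with () ← trans (sym (connectsB-complete G c)) h

connectsB-cong : ∀ {G H : Multigraph V} → G ⊆ H → H ⊆ G → ∀ u v → connectsB G u v ≡ connectsB H u v
connectsB-cong {G = G} {H} G⊆H H⊆G u v = bool-ext
  (connectsB-complete H ∘ Connected-mono G⊆H ∘ connectsB-sound G)
  (connectsB-complete G ∘ Connected-mono H⊆G ∘ connectsB-sound H)

connectsB-resp-↭ : ∀ {G H : Multigraph V} → G ↭ H → ∀ u v → connectsB G u v ≡ connectsB H u v
connectsB-resp-↭ G↭H = connectsB-cong (∈-resp-↭ G↭H) (∈-resp-↭ (↭-sym G↭H))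

ConnectedVia : Multigraph V → Edge V → Fin V → Fin V → Set
ConnectedVia M (x , y) u v =
  Connected M u v ⊎ (Connected M u x × Connected M y v) ⊎ (Connected M u y × Connected M x v)

Connected-∷⁻ : ∀ {M : Multigraph V} {x y u v} → Connected ((x , y) ∷ M) u v → ConnectedVia M (x , y) u v
Connected-∷⁻ c-refl                 = inj₁ c-refl
Connected-∷⁻ (c-edge (here refl))   = inj₂ (inj₁ (c-refl , c-refl))
Connected-∷⁻ (c-edge (there e))     = inj₁ (c-edge e)
Connected-∷⁻ (c-sym c) with Connected-∷⁻ c
... | inj₁ uv                 = inj₁ (c-sym uv)
... | inj₂ (inj₁ (ux , yv))   = inj₂ (inj₂ (c-sym yv , c-sym ux))
... | inj₂ (inj₂ (uy , xv))   = inj₂ (inj₁ (c-sym xv , c-sym uy))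
Connected-∷⁻ (c-trans c d) with Connected-∷⁻ c | Connected-∷⁻ d
... | inj₁ uv               | inj₁ vw               = inj₁ (c-trans uv vw)
... | inj₁ uv               | inj₂ (inj₁ (vx , yw)) = inj₂ (inj₁ (c-trans uv vx , yw))
... | inj₁ uv               | inj₂ (inj₂ (vy , xw)) = inj₂ (inj₂ (c-trans uv vy , xw))
... | inj₂ (inj₁ (ux , yv)) | inj₁ vw               = inj₂ (inj₁ (ux , c-trans yv vw))
... | inj₂ (inj₁ (ux , _))  | inj₂ (inj₁ (_ , yw))  = inj₂ (inj₁ (ux , yw))
... | inj₂ (inj₁ (ux , _))  | inj₂ (inj₂ (_ , xw))  = inj₁ (c-trans ux xw)
... | inj₂ (inj₂ (uy , xv)) | inj₁ vw               = inj₂ (inj₂ (uy , c-trans xv vw))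
... | inj₂ (inj₂ (uy , _))  | inj₂ (inj₁ (_ , yw))  = inj₁ (c-trans uy yw)
... | inj₂ (inj₂ (uy , _))  | inj₂ (inj₂ (_ , xw))  = inj₂ (inj₂ (uy , xw))

Connected-∷⁺ : ∀ {M : Multigraph V} {x y u v} → ConnectedVia M (x , y) u v → Connected ((x , y) ∷ M) u v
Connected-∷⁺ (inj₁ uv)               = Connected-mono there uv
Connected-∷⁺ (inj₂ (inj₁ (ux , yv))) =
  c-trans (Connected-mono there ux) (c-trans (c-edge (here refl)) (Connected-mono there yv))
Connected-∷⁺ (inj₂ (inj₂ (uy , xv))) =
  c-trans (Connected-mono there uy) (c-trans (c-sym (c-edge (here refl))) (Connected-mono there xv))

-- The exchange property of the cycle matroid.
exchange : ∀ {N : Multigraph V} {a₁ a₂ b₁ b₂} → Connected ((b₁ , b₂) ∷ N) a₁ a₂ →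
  Connected ((a₁ , a₂) ∷ N) b₁ b₂ ⊎ Connected N a₁ a₂
exchange c with Connected-∷⁻ c
... | inj₁ a                   = inj₂ a
... | inj₂ (inj₁ (ab₁ , b₂a))  =
  inj₁ (c-trans (c-sym (Connected-mono there ab₁)) (c-trans (c-edge (here refl)) (c-sym (Connected-mono there b₂a))))
... | inj₂ (inj₂ (ab₂ , b₁a))  =
  inj₁ (c-trans (Connected-mono there b₁a) (c-trans (c-sym (c-edge (here refl))) (Connected-mono there ab₂)))

-- Acyclicity

picks-⊆ : ∀ {A : Set} (L : List A) {z zs} → (z , zs) ∈ picks L → (z ∷ zs) ⊆ L
picks-⊆ (w ∷ ws) (here refl) e = e
picks-⊆ (w ∷ ws) (there p) e with ∈-map⁻ (λ { (z , zs) → z , w ∷ zs }) p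
... | (_ , p′ , refl) with e
...   | here refl         = there (picks-⊆ ws p′ (here refl))
...   | there (here refl) = here refl
...   | there (there e′)  = there (picks-⊆ ws p′ (there e′))

acyclicB-∷ : ∀ (x y : Fin V) L → acyclicB ((x , y) ∷ L) ≡ not (connectsB L x y) ∧ acyclicB L
acyclicB-∷ x y L with connectsB L x y in xy
... | true  = refl
... | false = cong (true ∧_) (go (picks L) (λ p → p))
  where
  -- As x and y are disconnected in L, no cycle through another edge of L uses (x , y).
  go : ∀ ps → (∀ {z} → z ∈ ps → z ∈ picks L) →
    all (λ { ((u , v) , rest) → not (connectsB rest u v) }) (map (λ { (z , zs) → z , (x , y) ∷ zs }) ps)
    ≡ all (λ { ((u , v) , rest) → not (connectsB rest u v) }) ps
  go []                    sub = refl
  go (((u , v) , rest) ∷ ps) sub = cong₂ (λ a b → not a ∧ b) same (go ps (sub ∘ there))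
    where
    uv∷rest⊆L : ((u , v) ∷ rest) ⊆ L
    uv∷rest⊆L = picks-⊆ L (sub (here refl))
    same : connectsB ((x , y) ∷ rest) u v ≡ connectsB rest u v
    same = bool-ext via-xy (connectsB-complete _ ∘ Connected-mono there ∘ connectsB-sound rest)
      where
      in-L : ∀ {a b} → Connected rest a b → Connected L a b
      in-L = Connected-mono (uv∷rest⊆L ∘ there)
      uv = c-edge (uv∷rest⊆L (here refl))
      via-xy : connectsB ((x , y) ∷ rest) u v ≡ true → connectsB rest u v ≡ true
      via-xy h with Connected-∷⁻ (connectsB-sound _ h)
      ... | inj₁ c = connectsB-complete rest c
      ... | inj₂ (inj₁ (ux , yv)) = ⊥-elim (connectsB-false L xy (c-trans (c-sym (in-L ux)) (c-trans uv (c-sym (in-L yv)))))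
      ... | inj₂ (inj₂ (uy , xv)) = ⊥-elim (connectsB-false L xy (c-trans (in-L xv) (c-trans (c-sym uv) (in-L uy))))

independent-sym : ∀ N (a b : Edge V) →
  not (connectsB (b ∷ N) (proj₁ a) (proj₂ a)) ∧ not (connectsB N (proj₁ b) (proj₂ b)) ≡ true →
  not (connectsB (a ∷ N) (proj₁ b) (proj₂ b)) ∧ not (connectsB N (proj₁ a) (proj₂ a)) ≡ true
independent-sym N (a₁ , a₂) (b₁ , b₂) h
  with connectsB ((b₁ , b₂) ∷ N) a₁ a₂ in C | connectsB N b₁ b₂ in B
     | connectsB ((a₁ , a₂) ∷ N) b₁ b₂ in D | connectsB N a₁ a₂ in A
... | false | false | false | false = refl
... | false | false | false | true  = ⊥-elim (connectsB-false _ C (Connected-mono there (connectsB-sound N A)))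
... | false | false | true  | _ with exchange (connectsB-sound _ D)
...   | inj₁ a = ⊥-elim (connectsB-false _ C a)
...   | inj₂ b = ⊥-elim (connectsB-false N B b)
independent-sym N _ _ () | true  | _    | _ | _
independent-sym N _ _ () | false | true | _ | _

acyclicB-swap : ∀ (a b : Edge V) N → acyclicB (a ∷ b ∷ N) ≡ acyclicB (b ∷ a ∷ N)
acyclicB-swap a@(a₁ , a₂) b@(b₁ , b₂) N
  rewrite acyclicB-∷ a₁ a₂ (b ∷ N) | acyclicB-∷ b₁ b₂ N | acyclicB-∷ b₁ b₂ (a ∷ N) | acyclicB-∷ a₁ a₂ N
  = begin
    not C ∧ (not B ∧ acyclicB N) ≡⟨ ∧-assoc (not C) (not B) _ ⟨
    (not C ∧ not B) ∧ acyclicB N ≡⟨ cong (_∧ acyclicB N) (bool-ext (independent-sym N a b) (independent-sym N b a)) ⟩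
    (not D ∧ not A) ∧ acyclicB N ≡⟨ ∧-assoc (not D) (not A) _ ⟩
    not D ∧ (not A ∧ acyclicB N) ∎
  where
  open ≡-Reasoning
  C = connectsB (b ∷ N) a₁ a₂
  B = connectsB N b₁ b₂
  D = connectsB (a ∷ N) b₁ b₂
  A = connectsB N a₁ a₂

acyclicB-∷-cong : ∀ (e : Edge V) {G H} → G ↭ H → acyclicB G ≡ acyclicB H → acyclicB (e ∷ G) ≡ acyclicB (e ∷ H)
acyclicB-∷-cong (x , y) {G} {H} G↭H eq = begin
  acyclicB ((x , y) ∷ G)               ≡⟨ acyclicB-∷ x y G ⟩
  not (connectsB G x y) ∧ acyclicB G  ≡⟨ cong₂ (λ a b → not a ∧ b) (connectsB-resp-↭ G↭H x y) eq ⟩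
  not (connectsB H x y) ∧ acyclicB H  ≡⟨ acyclicB-∷ x y H ⟨
  acyclicB ((x , y) ∷ H)               ∎
  where open ≡-Reasoning

acyclicB-resp-↭ : ∀ {G H : Multigraph V} → G ↭ H → acyclicB G ≡ acyclicB H
acyclicB-resp-↭ ↭.refl               = refl
acyclicB-resp-↭ (↭.prep e G↭H)       = acyclicB-∷-cong e G↭H (acyclicB-resp-↭ G↭H)
acyclicB-resp-↭ {G = a ∷ b ∷ G} (↭.swap .a .b G↭H) =
  trans (acyclicB-swap a b G) (acyclicB-∷-cong b (↭.prep a G↭H) (acyclicB-∷-cong a G↭H (acyclicB-resp-↭ G↭H)))
acyclicB-resp-↭ (↭.trans G↭H H↭K)    = trans (acyclicB-resp-↭ G↭H) (acyclicB-resp-↭ H↭K)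

all-cong : ∀ {A : Set} {p q : A → Bool} → p ≗ q → ∀ xs → all p xs ≡ all q xs
all-cong p≗q []       = refl
all-cong p≗q (x ∷ xs) = cong₂ _∧_ (p≗q x) (all-cong p≗q xs)

connectedB-resp-↭ : ∀ {G H : Multigraph V} → G ↭ H → connectedB G ≡ connectedB H
connectedB-resp-↭ {V} G↭H = all-cong (λ u → all-cong (connectsB-resp-↭ G↭H u) (allFin V)) (allFin V)

isSpanningTreeB-resp-↭ : ∀ {G H : Multigraph V} → G ↭ H → isSpanningTreeB G ≡ isSpanningTreeB H
isSpanningTreeB-resp-↭ G↭H = cong₂ _∧_ (connectedB-resp-↭ G↭H) (acyclicB-resp-↭ G↭H)

acyclicB-++⁻ʳ : ∀ (A B : Multigraph V) → acyclicB (A ++ B) ≡ true → acyclicB B ≡ true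
acyclicB-++⁻ʳ []            B h = h
acyclicB-++⁻ʳ ((x , y) ∷ A) B h
  with connectsB (A ++ B) x y | acyclicB (A ++ B) in acAB | trans (sym (acyclicB-∷ x y (A ++ B))) h
... | false | true | _ = acyclicB-++⁻ʳ A B acAB

-- Counting spanning trees edge by edge

countᵇ : ∀ {A : Set} → (A → Bool) → List A → ℕ
countᵇ p []       = 0
countᵇ p (x ∷ xs) = (if p x then 1 else 0) + countᵇ p xs

length-filter≡countᵇ : ∀ {A : Set} (p : A → Bool) xs → length (filter (T? ∘ p) xs) ≡ countᵇ p xs
length-filter≡countᵇ p []       = refl
length-filter≡countᵇ p (x ∷ xs) with p x
... | true  = cong suc (length-filter≡countᵇ p xs)
... | false = length-filter≡countᵇ p xs

countᵇ-++ : ∀ {A : Set} (p : A → Bool) xs ys → countᵇ p (xs ++ ys) ≡ countᵇ p xs + countᵇ p ys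
countᵇ-++ p []       ys = refl
countᵇ-++ p (x ∷ xs) ys rewrite countᵇ-++ p xs ys with p x
... | true  = refl
... | false = refl

countᵇ-map : ∀ {A B : Set} (p : B → Bool) (f : A → B) xs → countᵇ p (map f xs) ≡ countᵇ (p ∘ f) xs
countᵇ-map p f []       = refl
countᵇ-map p f (x ∷ xs) = cong ((if p (f x) then 1 else 0) +_) (countᵇ-map p f xs)

countᵇ-cong : ∀ {A : Set} {p q : A → Bool} → p ≗ q → ∀ xs → countᵇ p xs ≡ countᵇ q xs
countᵇ-cong p≗q []       = refl
countᵇ-cong p≗q (x ∷ xs) = cong₂ (λ b n → (if b then 1 else 0) + n) (p≗q x) (countᵇ-cong p≗q xs)

countᵇ-none : ∀ {A : Set} {p : A → Bool} → (∀ x → p x ≡ false) → ∀ xs → countᵇ p xs ≡ 0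
countᵇ-none none []       = refl
countᵇ-none none (x ∷ xs) rewrite none x = countᵇ-none none xs

countᵇ-tabulate : ∀ {A : Set} {N} (P : A → Bool) (g : Fin N → A) →
  countᵇ P (tabulate g) ≡ sum (λ i → if P (g i) then 1 else 0)
countᵇ-tabulate {N = zero}  P g = refl
countᵇ-tabulate {N = suc N} P g = cong ((if P (g zero) then 1 else 0) +_) (countᵇ-tabulate P (g ∘ suc))

extensions : Multigraph V → Multigraph V → ℕ
extensions G S = countᵇ (λ S′ → isSpanningTreeB (S′ ++ S)) (sublists G)

t≡extensions : ∀ (G : Multigraph V) → t G ≡ extensions G []
t≡extensions G = trans (length-filter≡countᵇ isSpanningTreeB (sublists G))
  (countᵇ-cong (λ S′ → cong isSpanningTreeB (sym (++-identityʳ S′))) (sublists G))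

extensions-∷ : ∀ (e : Edge V) G S → extensions (e ∷ G) S ≡ extensions G (e ∷ S) + extensions G S
extensions-∷ e G S = begin
  extensions (e ∷ G) S
    ≡⟨ countᵇ-++ _ (map (e ∷_) (sublists G)) (sublists G) ⟩
  countᵇ (λ S′ → isSpanningTreeB (S′ ++ S)) (map (e ∷_) (sublists G)) + extensions G S
    ≡⟨ cong (_+ extensions G S) (countᵇ-map _ (e ∷_) (sublists G)) ⟩
  countᵇ (λ S′ → isSpanningTreeB (e ∷ S′ ++ S)) (sublists G) + extensions G S
    ≡⟨ cong (_+ extensions G S) (countᵇ-cong (λ S′ → isSpanningTreeB-resp-↭ (shift e S′ S)) (sublists G)) ⟨
  extensions G (e ∷ S) + extensions G S
    ∎
  where open ≡-Reasoning

Labelling : ℕ → Set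
Labelling V = Fin V → Fin V

_==_ : Fin V → Fin V → Bool
a == b = does (a ≟ b)

does-true⁻ : ∀ {P : Set} (P? : Dec P) → does P? ≡ true → P
does-true⁻ (yes p) _ = p

==⇒≡ : ∀ {a b : Fin V} → a == b ≡ true → a ≡ b
==⇒≡ {a = a} {b} = does-true⁻ (a ≟ b)

==-sym : ∀ (a b : Fin V) → (a == b) ≡ (b == a)
==-sym a b = bool-ext (λ e → dec-true (b ≟ a) (sym (==⇒≡ e))) (λ e → dec-true (a ≟ b) (sym (==⇒≡ e)))

allEqualB : Labelling V → Bool
allEqualB {V} f = all (λ u → all (λ v → f u == f v) (allFin V)) (allFin V)

all-true⁺ : ∀ {A : Set} {p : A → Bool} → (∀ x → p x ≡ true) → ∀ xs → all p xs ≡ true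
all-true⁺ all-p []       = refl
all-true⁺ all-p (x ∷ xs) rewrite all-p x = all-true⁺ all-p xs

all-true⁻ : ∀ {A : Set} {p : A → Bool} {xs x} → all p xs ≡ true → x ∈ xs → p x ≡ true
all-true⁻ {p = p} {x ∷ xs} h (here refl) = ∧-conicalˡ (p x) _ h
all-true⁻ {p = p} {x ∷ xs} h (there e)   = all-true⁻ (∧-conicalʳ (p x) _ h) e

allEqualB-const : ∀ (f : Labelling V) c → (∀ u → f u ≡ c) → allEqualB f ≡ true
allEqualB-const {V} f c const =
  all-true⁺ (λ u → all-true⁺ (λ v → dec-true (f u ≟ f v) (trans (const u) (sym (const v)))) (allFin V)) (allFin V)

allEqualB-≢ : ∀ (f : Labelling V) {u v} → f u ≢ f v → allEqualB f ≡ false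
allEqualB-≢ f {u} {v} fu≢fv with allEqualB f in all-equal
... | false = refl
... | true  = ⊥-elim (fu≢fv (==⇒≡ (all-true⁻ (all-true⁻ all-equal (∈-allFin u)) (∈-allFin v))))

merge : Labelling V → Fin V → Fin V → Labelling V
merge f x y w = if f w == f x then f y else f w

-- Deletion–contraction: each edge of G is either left out or, when it joins two different
-- classes of the current labelling, taken, which merges the two classes.
completions : Multigraph V → Labelling V → ℕ
completions []            f = if allEqualB f then 1 else 0
completions ((x , y) ∷ G) f = (if f x == f y then 0 else completions G (merge f x y)) + completions G f

LabelsComponents : Multigraph V → Labelling V → Set
LabelsComponents S f = ∀ u v → connectsB S u v ≡ (f u == f v)

module _ {S : Multigraph V} (f : Labelling V) (labels : LabelsComponents S f) where

  LabelsComponents⇒≡ : ∀ {a b} → Connected S a b → f a ≡ f b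
  LabelsComponents⇒≡ {a} {b} c = ==⇒≡ (trans (sym (labels a b)) (connectsB-complete S c))

  LabelsComponents⇒Connected : ∀ {a b} → f a ≡ f b → Connected S a b
  LabelsComponents⇒Connected {a} {b} fa≡fb = connectsB-sound S (trans (labels a b) (dec-true (f a ≟ f b) fa≡fb))

merge-≡ : ∀ (f : Labelling V) x y {w} → f w ≡ f x → merge f x y w ≡ f y
merge-≡ f x y {w} fw≡fx rewrite dec-true (f w ≟ f x) fw≡fx = refl

merge-≢ : ∀ (f : Labelling V) x y {w} → f w ≢ f x → merge f x y w ≡ f w
merge-≢ f x y {w} fw≢fx rewrite dec-false (f w ≟ f x) fw≢fx = refl

LabelsComponents-merge : ∀ {S : Multigraph V} {f} x y → LabelsComponents S f → f x ≢ f y →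
  LabelsComponents ((x , y) ∷ S) (merge f x y)
LabelsComponents-merge {S = S} {f} x y labels fx≢fy u v = bool-ext
  (λ h → dec-true (g u ≟ g v) (⇒≡ (Connected-∷⁻ (connectsB-sound _ h))))
  (λ h → connectsB-complete _ (Connected-∷⁺ (⇐≡ (f u ≟ f x) (f v ≟ f x) (==⇒≡ h))))
  where
  g = merge f x y
  same : ∀ {a b} → Connected S a b → f a ≡ f b
  same = LabelsComponents⇒≡ f labels
  joined : ∀ {a b} → f a ≡ f b → Connected S a b
  joined = LabelsComponents⇒Connected f labels
  ⇒≡ : ConnectedVia S (x , y) u v → g u ≡ g v
  ⇒≡ (inj₁ uv) = cong (λ z → if z == f x then f y else z) (same uv)
  ⇒≡ (inj₂ (inj₁ (ux , yv))) =
    trans (merge-≡ f x y (same ux)) (trans (same yv) (sym (merge-≢ f x y λ fv≡fx → fx≢fy (sym (trans (same yv) fv≡fx)))))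
  ⇒≡ (inj₂ (inj₂ (uy , xv))) =
    trans (merge-≢ f x y λ fu≡fx → fx≢fy (sym (trans (sym (same uy)) fu≡fx))) (trans (same uy) (sym (merge-≡ f x y (sym (same xv)))))
  ⇐≡ : Dec (f u ≡ f x) → Dec (f v ≡ f x) → g u ≡ g v → ConnectedVia S (x , y) u v
  ⇐≡ (yes ux) (yes vx) _  = inj₁ (joined (trans ux (sym vx)))
  ⇐≡ (yes ux) (no  vx) eq = inj₂ (inj₁ (joined ux , joined (trans (sym (merge-≡ f x y ux)) (trans eq (merge-≢ f x y vx)))))
  ⇐≡ (no  ux) (yes vx) eq = inj₂ (inj₂ (joined (trans (sym (merge-≢ f x y ux)) (trans eq (merge-≡ f x y vx))) , joined (sym vx)))
  ⇐≡ (no  ux) (no  vx) eq = inj₁ (joined (trans (sym (merge-≢ f x y ux)) (trans eq (merge-≢ f x y vx))))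

extensions≡completions : ∀ (G S : Multigraph V) f → acyclicB S ≡ true → LabelsComponents S f →
  extensions G S ≡ completions G f
extensions≡completions {V} [] S f acyclic labels
  rewrite acyclic | all-cong (λ u → all-cong (labels u) (allFin V)) (allFin V)
        | ∧-identityʳ (allEqualB f) = +-identityʳ _
extensions≡completions ((x , y) ∷ G) S f acyclic labels
  rewrite extensions-∷ (x , y) G S with f x ≟ f y
... | yes fx≡fy = cong₂ _+_ (countᵇ-none not-tree (sublists G)) (extensions≡completions G S f acyclic labels)
  where
  cyclic : acyclicB ((x , y) ∷ S) ≡ false
  cyclic rewrite acyclicB-∷ x y S | labels x y | dec-true (f x ≟ f y) fx≡fy = refl
  not-tree : ∀ S′ → isSpanningTreeB (S′ ++ (x , y) ∷ S) ≡ false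
  not-tree S′ with acyclicB (S′ ++ (x , y) ∷ S) in acyclic′
  ... | true  with () ← trans (sym (acyclicB-++⁻ʳ S′ _ acyclic′)) cyclic
  ... | false = ∧-zeroʳ _
... | no fx≢fy = cong₂ _+_
  (extensions≡completions G ((x , y) ∷ S) (merge f x y) acyclic′ (LabelsComponents-merge {S = S} x y labels fx≢fy))
  (extensions≡completions G S f acyclic labels)
  where
  acyclic′ : acyclicB ((x , y) ∷ S) ≡ true
  acyclic′ rewrite acyclicB-∷ x y S | labels x y | dec-false (f x ≟ f y) fx≢fy = acyclic

t≡completions : ∀ (G : Multigraph V) → t G ≡ completions G (λ v → v)
t≡completions G = trans (t≡extensions G) (extensions≡completions G [] (λ v → v) refl discrete)
  where
  discrete : LabelsComponents [] (λ v → v)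
  discrete u v = bool-ext (λ h → dec-true (u ≟ v) (Connected-[] (connectsB-sound [] h)))
                          (λ h → connectsB-complete [] (subst (Connected [] u) (==⇒≡ h) c-refl))

#labelled : Labelling V → List (Fin V) → Fin V → ℕ
#labelled f us v = countᵇ (λ u → f u == v) us

sum-δ : ∀ (u : Fin V) → sum (λ v → if u == v then 1 else 0) ≡ 1
sum-δ {suc V} zero    = cong suc (sum-replicate-zero V)
sum-δ {suc V} (suc u) = sum-δ u

sum-#labelled : ∀ (f : Labelling V) us → sum (#labelled f us) ≡ length us
sum-#labelled {V} f []  = sum-replicate-zero V
sum-#labelled f (u ∷ us) = begin
  sum (λ v → (if f u == v then 1 else 0) + #labelled f us v)    ≡⟨ ∑-distrib-+ _ (#labelled f us) ⟩
  sum (λ v → if f u == v then 1 else 0) + sum (#labelled f us)  ≡⟨ cong₂ _+_ (sum-δ (f u)) (sum-#labelled f us) ⟩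
  suc (length us)                                               ∎
  where open ≡-Reasoning

module _ (f : Labelling V) (a b : Fin V) where

  merge-==-other : ∀ w {v} → v ≢ f a → v ≢ f b → (merge f a b w == v) ≡ (f w == v)
  merge-==-other w {v} v≢X v≢Y with f w ≟ f a
  ... | yes fw≡X rewrite fw≡X = trans (dec-false (f b ≟ v) (v≢Y ∘ sym)) (sym (dec-false (f a ≟ v) (v≢X ∘ sym)))
  ... | no _     = refl

  #labelled-merge-other : ∀ us {v} → v ≢ f a → v ≢ f b → #labelled (merge f a b) us v ≡ #labelled f us v
  #labelled-merge-other us v≢X v≢Y = countᵇ-cong (λ w → merge-==-other w v≢X v≢Y) us

  #labelled-merge-target : f a ≢ f b → ∀ us → #labelled (merge f a b) us (f b) ≡ #labelled f us (f b) + #labelled f us (f a)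
  #labelled-merge-target X≢Y []       = refl
  #labelled-merge-target X≢Y (u ∷ us) rewrite #labelled-merge-target X≢Y us with f u ≟ f a
  ... | yes fu≡X rewrite fu≡X | dec-true (f b ≟ f b) refl | dec-false (f a ≟ f b) X≢Y = sym (+-suc _ _)
  ... | no _ with f u ≟ f b
  ...   | yes _ = refl
  ...   | no _  = refl

completions-replicate-≡ : ∀ w (x y : Fin V) G f → f x ≡ f y →
  completions (replicate w (x , y) ++ G) f ≡ completions G f
completions-replicate-≡ zero    x y G f fx≡fy = refl
completions-replicate-≡ (suc w) x y G f fx≡fy
  rewrite dec-true (f x ≟ f y) fx≡fy = completions-replicate-≡ w x y G f fx≡fy

completions-replicate-≢ : ∀ w (x y : Fin V) G f → f x ≢ f y →
  completions (replicate w (x , y) ++ G) f ≡ w * completions G (merge f x y) + completions G f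
completions-replicate-≢ zero    x y G f fx≢fy = refl
completions-replicate-≢ (suc w) x y G f fx≢fy rewrite dec-false (f x ≟ f y) fx≢fy = begin
  completions (replicate w (x , y) ++ G) g + completions (replicate w (x , y) ++ G) f
    ≡⟨ cong₂ _+_ (completions-replicate-≡ w x y G g merged) (completions-replicate-≢ w x y G f fx≢fy) ⟩
  completions G g + (w * completions G g + completions G f)
    ≡⟨ +-assoc (completions G g) _ _ ⟨
  completions G g + w * completions G g + completions G f ∎
  where
  open ≡-Reasoning
  g = merge f x y
  merged : g x ≡ g y
  merged rewrite dec-true (f x ≟ f x) refl with f y ≟ f x
  ... | yes _ = refl
  ... | no  _ = refl

-- Along a star of edges c–tip a (a ∈ as), each of multiplicity w, a closed form Φ that obeys the
-- deletion–contraction recursion edge by edge counts the completions.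
completions-star : ∀ (w : ℕ) (c : Fin V) {A : Set} (tip : A → Fin V) (later : Multigraph V)
  (Inv : Labelling V → Set) (Φ : Labelling V → List A → ℕ) →
  (∀ {f} → Inv f → completions later f ≡ Φ f []) →
  (∀ {f} a as → Inv f → f c ≡ f (tip a) → Φ f (a ∷ as) ≡ Φ f as) →
  (∀ {f} a as → Inv f → f c ≢ f (tip a) → Φ f (a ∷ as) ≡ w * Φ (merge f c (tip a)) as + Φ f as) →
  (∀ {f} a → Inv f → f c ≢ f (tip a) → Inv (merge f c (tip a))) →
  ∀ as {f} → Inv f → completions (concatMap (λ a → replicate w (c , tip a)) as ++ later) f ≡ Φ f as
completions-star w c tip later Inv Φ base same join Inv-merge = go
  where
  go : ∀ as {f} → Inv f → completions (concatMap (λ a → replicate w (c , tip a)) as ++ later) f ≡ Φ f as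
  go []       inv = base inv
  go (a ∷ as) {f} inv
    rewrite ++-assoc (replicate w (c , tip a)) (concatMap (λ a → replicate w (c , tip a)) as) later
    with f c ≟ f (tip a)
  ... | yes fc≡fa = trans (completions-replicate-≡ w c (tip a) _ f fc≡fa) (trans (go as inv) (sym (same a as inv fc≡fa)))
  ... | no  fc≢fa = begin
    completions (replicate w (c , tip a) ++ rest) f          ≡⟨ completions-replicate-≢ w c (tip a) rest f fc≢fa ⟩
    w * completions rest (merge f c (tip a)) + completions rest f
      ≡⟨ cong₂ (λ x y → w * x + y) (go as (Inv-merge a inv fc≢fa)) (go as inv) ⟩
    w * Φ (merge f c (tip a)) as + Φ f as                   ≡⟨ join a as inv fc≢fa ⟨
    Φ f (a ∷ as)                                            ∎
    where
    open ≡-Reasoning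
    rest = concatMap (λ a → replicate w (c , tip a)) as ++ later

-- Dual numbers: (a , b) stands for a + b ε with ε² = 0.

Dual : Set
Dual = ℕ × ℕ

infixl 7 _⊗_
_⊗_ : Dual → Dual → Dual
(a , b) ⊗ (c , d) = a * c , a * d + b * c

1ᵈ : Dual
1ᵈ = 1 , 0

⊗-comm : ∀ x y → x ⊗ y ≡ y ⊗ x
⊗-comm (a , b) (c , d) = cong₂ _,_ (*-comm a c) (comm a b c d)
  where
  comm : ∀ a b c d → a * d + b * c ≡ c * b + d * a
  comm = solve-∀

⊗-assoc : ∀ x y z → x ⊗ y ⊗ z ≡ x ⊗ (y ⊗ z)
⊗-assoc (a , b) (c , d) (e , f) = cong₂ _,_ (assoc₁ a c e) (assoc₂ a b c d e f)
  where
  assoc₁ : ∀ a c e → a * c * e ≡ a * (c * e)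
  assoc₁ = solve-∀
  assoc₂ : ∀ a b c d e f → a * c * f + (a * d + b * c) * e ≡ a * (c * f + d * e) + b * (c * e)
  assoc₂ = solve-∀

⊗-identityˡ : ∀ x → 1ᵈ ⊗ x ≡ x
⊗-identityˡ (c , d) = cong₂ _,_ (+-identityʳ c) (unit c d)
  where
  unit : ∀ c d → 1 * d + 0 * c ≡ d
  unit = solve-∀

∏ : (Fin V → Dual) → Dual
∏ {zero}  F = 1ᵈ
∏ {suc V} F = F zero ⊗ ∏ (F ∘ suc)

∏-cong : ∀ {F G : Fin V → Dual} → F ≗ G → ∏ F ≡ ∏ G
∏-cong {zero}  F≗G = refl
∏-cong {suc V} F≗G = cong₂ _⊗_ (F≗G zero) (∏-cong (F≗G ∘ suc))

without : (Fin V → Dual) → Fin V → Fin V → Dual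
without F x v = if v == x then 1ᵈ else F v

without-≢ : ∀ (F : Fin V → Dual) {x v} → v ≢ x → without F x v ≡ F v
without-≢ F {x} {v} v≢x rewrite dec-false (v ≟ x) v≢x = refl

∏-extract : ∀ (F : Fin V → Dual) x → ∏ F ≡ F x ⊗ ∏ (without F x)
∏-extract {suc V} F zero    = cong (F zero ⊗_) (sym (⊗-identityˡ _))
∏-extract {suc V} F (suc x) = begin
  F zero ⊗ ∏ (F ∘ suc)                     ≡⟨ cong (F zero ⊗_) (∏-extract (F ∘ suc) x) ⟩
  F zero ⊗ (F (suc x) ⊗ R)                 ≡⟨ ⊗-assoc (F zero) _ R ⟨
  F zero ⊗ F (suc x) ⊗ R                   ≡⟨ cong (_⊗ R) (⊗-comm (F zero) _) ⟩
  F (suc x) ⊗ F zero ⊗ R                   ≡⟨ ⊗-assoc (F (suc x)) _ R ⟩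
  F (suc x) ⊗ ∏ (without F (suc x))        ∎
  where
  open ≡-Reasoning
  R = ∏ (without (F ∘ suc) x)

∏-split₂ : ∀ (F G : Fin V → Dual) {x y} → x ≢ y → (∀ v → v ≢ x → v ≢ y → F v ≡ G v) →
  ∏ F ≡ F x ⊗ (F y ⊗ ∏ (without (without G x) y))
∏-split₂ F G {x} {y} x≢y agree = begin
  ∏ F
    ≡⟨ ∏-extract F x ⟩
  F x ⊗ ∏ (without F x)
    ≡⟨ cong (F x ⊗_) (∏-extract (without F x) y) ⟩
  F x ⊗ (without F x y ⊗ ∏ (without (without F x) y))
    ≡⟨ cong₂ (λ a b → F x ⊗ (a ⊗ b)) (without-≢ F (x≢y ∘ sym)) (∏-cong pointwise) ⟩
  F x ⊗ (F y ⊗ ∏ (without (without G x) y))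
    ∎
  where
  open ≡-Reasoning
  pointwise : ∀ v → without (without F x) y v ≡ without (without G x) y v
  pointwise v with v ≟ y
  ... | yes _ = refl
  ... | no v≢y with v ≟ x
  ...   | yes _   = refl
  ...   | no  v≢x = agree v v≢x v≢y

∏-absorbing : ∀ (F : Fin V → Dual) x → F x ≡ (0 , 0) → ∏ F ≡ (0 , 0)
∏-absorbing F x Fx≡0 rewrite ∏-extract F x | Fx≡0 = refl

proj₁-∏-zero : ∀ (F : Fin V → Dual) x → proj₁ (F x) ≡ 0 → proj₁ (∏ F) ≡ 0
proj₁-∏-zero F x Fx≡0 rewrite ∏-extract F x with F x
... | (_ , _) rewrite Fx≡0 = refl

proj₂-∏-zero : ∀ (F : Fin V → Dual) → (∀ v → proj₂ (F v) ≡ 0) → proj₂ (∏ F) ≡ 0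
proj₂-∏-zero {zero}  F all0 = refl
proj₂-∏-zero {suc V} F all0 with F zero | all0 zero | ∏ (F ∘ suc) | proj₂-∏-zero (F ∘ suc) (all0 ∘ suc)
... | (a , .0) | refl | (c , .0) | refl = trans (+-identityʳ (a * 0)) (*-zeroʳ a)

∏-one : ∀ (F : Fin V → Dual) → (∀ v → F v ≡ 1ᵈ) → ∏ F ≡ 1ᵈ
∏-one {zero}  F all1 = refl
∏-one {suc V} F all1 rewrite all1 zero | ∏-one (F ∘ suc) (all1 ∘ suc) = refl

proj₁-∏-cong : ∀ (F G : Fin V → Dual) → (∀ v → proj₁ (F v) ≡ proj₁ (G v)) → proj₁ (∏ F) ≡ proj₁ (∏ G)
proj₁-∏-cong {zero}  F G eq = refl
proj₁-∏-cong {suc V} F G eq = cong₂ _*_ (eq zero) (proj₁-∏-cong (F ∘ suc) (G ∘ suc) (eq ∘ suc))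

proj₁-∏-prefix : ∀ a n′ {m′} (F : Fin (n′ + m′) → Dual) →
  (∀ v → proj₁ (F v) ≡ (if does (toℕ v <? n′) then a else 1)) → proj₁ (∏ F) ≡ a ^ n′
proj₁-∏-prefix a zero {m′} F h =
  trans (proj₁-∏-cong F (λ _ → 1ᵈ) h) (cong proj₁ (∏-one {m′} (λ _ → 1ᵈ) (λ _ → refl)))
proj₁-∏-prefix a (suc n′) F h = cong₂ _*_ (h zero) (proj₁-∏-prefix a n′ (F ∘ suc) (h ∘ suc))

-- Each factor Y a + a² ε has logarithmic derivative a / Y.
∏-log-derivative : ∀ (Y : ℕ) (F : Fin V → Dual) (a : Fin V → ℕ) →
  (∀ v → F v ≡ (Y * a v , a v * a v) ⊎ (F v ≡ 1ᵈ × a v ≡ 0)) →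
  Y * proj₂ (∏ F) ≡ proj₁ (∏ F) * sum a
∏-log-derivative {zero}  Y F a shape = *-zeroʳ Y
∏-log-derivative {suc V} Y F a shape
  with ∏ (F ∘ suc) | ∏-log-derivative Y (F ∘ suc) (a ∘ suc) (shape ∘ suc) | shape zero
... | (U , D) | ih | inj₁ F0 rewrite F0 = begin
  Y * (Y * a₀ * D + a₀ * a₀ * U)    ≡⟨ expand Y a₀ D U ⟩
  Y * a₀ * (Y * D) + Y * a₀ * a₀ * U ≡⟨ cong (λ z → Y * a₀ * z + Y * a₀ * a₀ * U) ih ⟩
  Y * a₀ * (U * S) + Y * a₀ * a₀ * U ≡⟨ collect Y a₀ U S ⟩
  Y * a₀ * U * (a₀ + S)              ∎
  where
  open ≡-Reasoning
  a₀ = a zero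
  S = sum (a ∘ suc)
  expand : ∀ Y a D U → Y * (Y * a * D + a * a * U) ≡ Y * a * (Y * D) + Y * a * a * U
  expand = solve-∀
  collect : ∀ Y a U S → Y * a * (U * S) + Y * a * a * U ≡ Y * a * U * (a + S)
  collect = solve-∀
... | (U , D) | ih | inj₂ (F0 , a₀≡0) rewrite F0 | a₀≡0 =
  trans (cong (Y *_) (unit U D)) (trans ih (cong (_* sum (a ∘ suc)) (sym (+-identityʳ U))))
  where
  unit : ∀ U D → 1 * D + 0 * U ≡ D
  unit = solve-∀

drop-tabulate : ∀ {A : Set} {N} (g : Fin N → A) (j : Fin N) →
  drop (toℕ j) (tabulate g) ≡ g j ∷ drop (suc (toℕ j)) (tabulate g)
drop-tabulate g zero    = refl
drop-tabulate g (suc j) = drop-tabulate (g ∘ suc) j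

<?-suc : ∀ {a b} → a ≢ b → does (a <? suc b) ≡ does (a <? b)
<?-suc {a} {b} a≢b = bool-ext
  (λ h → dec-true (a <? b) (≤∧≢⇒< (s≤s⁻¹ (does-true⁻ (a <? suc b) h)) a≢b))
  (λ h → dec-true (a <? suc b) (m<n⇒m<1+n (does-true⁻ (a <? b) h)))

module Count (m n k : ℕ) where

  Vertex : Set
  Vertex = Fin (n + m)

  p : Fin n → Vertex
  p i = i ↑ˡ m

  q : Fin m → Vertex
  q j = n ↑ʳ j

  isP : Vertex → Bool
  isP v = does (toℕ v <? n)

  toℕ-q : ∀ j → toℕ (q j) ≡ n + toℕ j
  toℕ-q j = toℕ-↑ʳ n j

  isP-p : ∀ i → isP (p i) ≡ true
  isP-p i = dec-true (toℕ (p i) <? n) (subst (_< n) (sym (toℕ-↑ˡ i m)) (toℕ<n i))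

  isP-q : ∀ j → isP (q j) ≡ false
  isP-q j = dec-false (toℕ (q j) <? n) (≤⇒≯ (subst (n ≤_) (sym (toℕ-q j)) (m≤m+n n (toℕ j))))

  isP-true : ∀ {v} → isP v ≡ true → toℕ v < n
  isP-true {v} = does-true⁻ (toℕ v <? n)

  p≢q : ∀ {v} j → isP v ≡ true → v ≢ q j
  p≢q j v∈P v≡q = true≢false (trans (sym v∈P) (trans (cong isP v≡q) (isP-q j)))

  -- The labellings met after the stars of q₀, …, q_{t-1}: each class is named by one of its
  -- vertices, by a p whenever it contains one, and the later q's are still alone.
  record Admissible (t : ℕ) (f : Labelling (n + m)) : Set where
    field
      idempotent : ∀ v → f (f v) ≡ f v
      p-named-by-p : ∀ i → isP (f (p i)) ≡ true
      q-alone-or-named-by-p : ∀ v → isP v ≡ false → f v ≡ v ⊎ isP (f v) ≡ true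
      untouched : ∀ v → n + t ≤ toℕ v → f v ≡ v
  open Admissible

  Admissible-suc : ∀ {t f} → Admissible t f → Admissible (suc t) f
  Admissible-suc {t} adm = record
    { idempotent = idempotent adm
    ; p-named-by-p = p-named-by-p adm
    ; q-alone-or-named-by-p = q-alone-or-named-by-p adm
    ; untouched = λ v le → untouched adm v (≤-trans (+-monoʳ-≤ n (n≤1+n t)) le)
    }

  #in : Labelling (n + m) → List (Fin n) → Vertex → ℕ
  #in f is = #labelled f (map p is)

  size : Labelling (n + m) → Vertex → ℕ
  size f = #in f (allFin n)

  isRoot : Labelling (n + m) → Vertex → Bool
  isRoot f v = isP v ∧ f v == v

  -- v is a q before q_j that has stayed alone although all its edges are decided: no completion exists.
  isolated : Fin m → Labelling (n + m) → Vertex → Bool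
  isolated j f v = not (isP v) ∧ (f v == v ∧ does (toℕ v <? n + toℕ j))

  #in-non-p : ∀ {t f} → Admissible t f → ∀ is {v} → isP v ≡ false → #in f is v ≡ 0
  #in-non-p         adm []       v∉P = refl
  #in-non-p {f = f} adm (i ∷ is) {v} v∉P with f (p i) ≟ v
  ... | yes fpi≡v with () ← trans (sym (p-named-by-p adm i)) (trans (cong isP fpi≡v) v∉P)
  ... | no  _     = #in-non-p adm is v∉P

  #in-non-root : ∀ {t f} → Admissible t f → ∀ is {v} → f v ≢ v → #in f is v ≡ 0
  #in-non-root         adm []       fv≢v = refl
  #in-non-root {f = f} adm (i ∷ is) {v} fv≢v with f (p i) ≟ v
  ... | yes fpi≡v = ⊥-elim (fv≢v (trans (cong f (sym fpi≡v)) (trans (idempotent adm (p i)) fpi≡v)))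
  ... | no  _     = #in-non-root adm is fv≢v

  midFactor : ℕ → (root inClassOfQ : Bool) (c ρ : ℕ) (isolated : Bool) → Dual
  midFactor W true  true  c ρ _     = 1 , c
  midFactor W true  false c ρ _     = W * c + ρ , ρ * c
  midFactor W false _     c ρ true  = 0 , 0
  midFactor W false _     c ρ false = 1ᵈ

  lastFactor : (root inClassOfQ : Bool) (ρ : ℕ) (isolated : Bool) → Dual
  lastFactor true  true  ρ _     = 1ᵈ
  lastFactor true  false ρ _     = k * ρ , 0
  lastFactor false _     ρ true  = 0 , 0
  lastFactor false _     ρ false = 1ᵈ

  midFactors : ℕ → Fin m → Labelling (n + m) → List (Fin n) → Vertex → Dual
  midFactors W j f is v = midFactor W (isRoot f v) (v == f (q j)) (size f v) (#in f is v) (isolated j f v)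

  lastFactors : Fin m → Labelling (n + m) → List (Fin n) → Vertex → Dual
  lastFactors j f is v = lastFactor (isRoot f v) (v == f (q j)) (#in f is v) (isolated j f v)

  -- The completions of f while the edges q_j p_i (i ∈ is) and the stars of s + 1 later q's remain.
  midCount : ℕ → Fin m → Labelling (n + m) → List (Fin n) → ℕ
  midCount s j f is = k * n ^ s * proj₂ (∏ (midFactors (s + k) j f is))

  -- The completions of f while only the edges q_j p_i (i ∈ is) of the last star remain.
  lastCount : Fin m → Labelling (n + m) → List (Fin n) → ℕ
  lastCount j f is = proj₁ (∏ (lastFactors j f is))

  isolated-q : ∀ j g → isolated j g (q j) ≡ false
  isolated-q j g rewrite isP-q j | toℕ-q j
    | dec-false (n + toℕ j <? n + toℕ j) (n≮n _) = ∧-zeroʳ (g (q j) == q j)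

  isolated⇒non-p : ∀ j f v → isolated j f v ≡ true → isP v ≡ false
  isolated⇒non-p j f v h with isP v
  ... | false = refl

  midFactors-isolated : ∀ W j f is v → isolated j f v ≡ true → midFactors W j f is v ≡ (0 , 0)
  midFactors-isolated W j f is v h with isP v | h
  ... | false | alone rewrite alone = refl

  lastFactors-isolated : ∀ j f is v → isolated j f v ≡ true → lastFactors j f is v ≡ (0 , 0)
  lastFactors-isolated j f is v h with isP v | h
  ... | false | alone rewrite alone = refl

  rootSize : Labelling (n + m) → Vertex → ℕ
  rootSize f v = if isRoot f v then size f v else 0

  sum-rootSize : ∀ {t f} → Admissible t f → sum (rootSize f) ≡ n
  sum-rootSize {f = f} adm = begin
    sum (rootSize f)            ≡⟨ sum-cong-≗ rootSize≗size ⟩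
    sum (size f)                ≡⟨ sum-#labelled f (map p (allFin n)) ⟩
    length (map p (allFin n))   ≡⟨ length-map p (allFin n) ⟩
    length (allFin n)           ≡⟨ length-tabulate (λ i → i) ⟩
    n                           ∎
    where
    open ≡-Reasoning
    rootSize≗size : ∀ v → rootSize f v ≡ size f v
    rootSize≗size v with isP v in v∈P | f v ≟ v
    ... | true  | yes _    = refl
    ... | true  | no fv≢v  = sym (#in-non-root adm (allFin n) fv≢v)
    ... | false | _        = sym (#in-non-p adm (allFin n) v∈P)

  module Star (j : Fin m) {f : Labelling (n + m)} (adm : Admissible (suc (toℕ j)) f) where

    X = f (q j)

    X-alone-or-p : X ≡ q j ⊎ isP X ≡ true
    X-alone-or-p = q-alone-or-named-by-p adm (q j) (isP-q j)

    X-classes : (isRoot f X ≡ false × isolated j f X ≡ false × size f X ≡ 0) ⊎ isRoot f X ≡ true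
    X-classes with X-alone-or-p
    ... | inj₁ X≡q rewrite X≡q =
      inj₁ (cong (_∧ (f (q j) == q j)) (isP-q j) , isolated-q j f , #in-non-p adm (allFin n) (isP-q j))
    ... | inj₂ X∈P rewrite X∈P = inj₂ (dec-true (f X ≟ X) (idempotent adm (q j)))

    midFactors-X : ∀ W is → midFactors W j f is X ≡ (1 , size f X)
    midFactors-X W is with X-classes
    ... | inj₁ (nonroot , alone , empty) rewrite nonroot | alone | empty = refl
    ... | inj₂ root rewrite root | dec-true (X ≟ X) refl = refl

    lastFactors-X : ∀ is → lastFactors j f is X ≡ 1ᵈ
    lastFactors-X is with X-classes
    ... | inj₁ (nonroot , alone , _) rewrite nonroot | alone = refl
    ... | inj₂ root rewrite root | dec-true (X ≟ X) refl = refl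

    module Edge (i : Fin n) where

      Y = f (p i)

      isRoot-Y : isRoot f Y ≡ true
      isRoot-Y rewrite p-named-by-p adm i = dec-true (f Y ≟ Y) (idempotent adm (p i))

      #in-∷-Y : ∀ is → #in f (i ∷ is) Y ≡ suc (#in f is Y)
      #in-∷-Y is rewrite dec-true (Y ≟ Y) refl = refl

      #in-∷-other : ∀ is {v} → v ≢ Y → #in f (i ∷ is) v ≡ #in f is v
      #in-∷-other is v≢Y rewrite dec-false (Y ≟ _) (v≢Y ∘ sym) = refl

      midFactors-∷-same : X ≡ Y → ∀ W is → midFactors W j f (i ∷ is) ≗ midFactors W j f is
      midFactors-∷-same X≡Y W is v with v ≟ Y
      ... | no v≢Y rewrite #in-∷-other is v≢Y = refl
      ... | yes refl rewrite isRoot-Y | sym X≡Y | dec-true (X ≟ X) refl = refl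

      lastFactors-∷-same : X ≡ Y → ∀ is → lastFactors j f (i ∷ is) ≗ lastFactors j f is
      lastFactors-∷-same X≡Y is v with v ≟ Y
      ... | no v≢Y rewrite #in-∷-other is v≢Y = refl
      ... | yes refl rewrite isRoot-Y | sym X≡Y | dec-true (X ≟ X) refl = refl

      midCount-∷-same : X ≡ Y → ∀ s is → midCount s j f (i ∷ is) ≡ midCount s j f is
      midCount-∷-same X≡Y s is = cong (λ z → k * n ^ s * proj₂ z) (∏-cong (midFactors-∷-same X≡Y (s + k) is))

      lastCount-∷-same : X ≡ Y → ∀ is → lastCount j f (i ∷ is) ≡ lastCount j f is
      lastCount-∷-same X≡Y is = cong proj₁ (∏-cong (lastFactors-∷-same X≡Y is))

      midFactors-∷-other : ∀ W is {v} → v ≢ Y → midFactors W j f (i ∷ is) v ≡ midFactors W j f is v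
      midFactors-∷-other W is v≢Y rewrite #in-∷-other is v≢Y = refl

      lastFactors-∷-other : ∀ is {v} → v ≢ Y → lastFactors j f (i ∷ is) v ≡ lastFactors j f is v
      lastFactors-∷-other is v≢Y rewrite #in-∷-other is v≢Y = refl

      module Join (X≢Y : X ≢ Y) where

        g = merge f (q j) (p i)

        Y-fixed : f Y ≡ Y
        Y-fixed = idempotent adm (p i)

        g-Y : g Y ≡ Y
        g-Y = trans (merge-≢ f (q j) (p i) (λ fY≡X → X≢Y (sym (trans (sym Y-fixed) fY≡X)))) Y-fixed

        g-q : g (q j) ≡ Y
        g-q = merge-≡ f (q j) (p i) refl

        Admissible-merge : Admissible (suc (toℕ j)) g
        Admissible-merge = record
          { idempotent = idem
          ; p-named-by-p = λ i′ → named (p i′) (p-named-by-p adm i′)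
          ; q-alone-or-named-by-p = alone-or-named
          ; untouched = fresh
          }
          where
          named : ∀ v → isP (f v) ≡ true → isP (g v) ≡ true
          named v fv∈P with f v ≟ X
          ... | yes _ = p-named-by-p adm i
          ... | no  _ = fv∈P
          idem : ∀ v → g (g v) ≡ g v
          idem v with f v ≟ X
          ... | yes _    = g-Y
          ... | no fv≢X = trans (merge-≢ f (q j) (p i) (λ ffv≡X → fv≢X (trans (sym (idempotent adm v)) ffv≡X)))
                                (idempotent adm v)
          alone-or-named : ∀ v → isP v ≡ false → g v ≡ v ⊎ isP (g v) ≡ true
          alone-or-named v v∉P with f v ≟ X
          ... | yes _ = inj₂ (p-named-by-p adm i)
          ... | no  _ = q-alone-or-named-by-p adm v v∉P
          fresh : ∀ v → n + suc (toℕ j) ≤ toℕ v → g v ≡ v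
          fresh v le = trans (merge-≢ f (q j) (p i) fv≢X) fv≡v
            where
            fv≡v = untouched adm v le
            fv≢X : f v ≢ X
            fv≢X fv≡X with X-alone-or-p | trans (sym fv≡v) fv≡X
            ... | inj₁ X≡q | v≡X = ≤⇒≯ le (subst (_< n + suc (toℕ j)) (sym (trans (cong toℕ (trans v≡X X≡q)) (toℕ-q j)))
                                            (+-monoʳ-< n (n<1+n (toℕ j))))
            ... | inj₂ X∈P | v≡X = ≤⇒≯ le (≤-trans (isP-true (subst (λ z → isP z ≡ true) (sym v≡X) X∈P)) (m≤m+n n _))

        ==-g-q : ∀ v → (v == g (q j)) ≡ (v == Y)
        ==-g-q v = cong (v ==_) g-q

        g-X-trivial : isRoot g X ≡ false × isolated j g X ≡ false
        g-X-trivial with X-alone-or-p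
        ... | inj₁ X≡q = subst (λ x → isRoot g x ≡ false × isolated j g x ≡ false) (sym X≡q)
                           (cong (_∧ (g (q j) == q j)) (isP-q j) , isolated-q j g)
        ... | inj₂ X∈P rewrite X∈P =
          dec-false (g X ≟ X) (λ gX≡X → X≢Y (trans (sym gX≡X) (merge-≡ f (q j) (p i) (idempotent adm (q j))))) , refl

        midFactors-merge-other : ∀ W is {v} → v ≢ X → v ≢ Y → midFactors W j g is v ≡ midFactors W j f is v
        midFactors-merge-other W is {v} v≢X v≢Y
          rewrite merge-==-other f (q j) (p i) v v≢X v≢Y | ==-g-q v | dec-false (v ≟ Y) v≢Y | dec-false (v ≟ X) v≢X
                | #labelled-merge-other f (q j) (p i) (map p (allFin n)) v≢X v≢Y
                | #labelled-merge-other f (q j) (p i) (map p is) v≢X v≢Y = refl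

        lastFactors-merge-other : ∀ is {v} → v ≢ X → v ≢ Y → lastFactors j g is v ≡ lastFactors j f is v
        lastFactors-merge-other is {v} v≢X v≢Y
          rewrite merge-==-other f (q j) (p i) v v≢X v≢Y | ==-g-q v | dec-false (v ≟ Y) v≢Y | dec-false (v ≟ X) v≢X
                | #labelled-merge-other f (q j) (p i) (map p is) v≢X v≢Y = refl

        midFactors-merge-X : ∀ W is → midFactors W j g is X ≡ 1ᵈ
        midFactors-merge-X W is rewrite proj₁ g-X-trivial | proj₂ g-X-trivial = refl

        lastFactors-merge-X : ∀ is → lastFactors j g is X ≡ 1ᵈ
        lastFactors-merge-X is rewrite proj₁ g-X-trivial | proj₂ g-X-trivial = refl

        isRoot-g-Y : isRoot g Y ≡ true
        isRoot-g-Y rewrite p-named-by-p adm i = dec-true (g Y ≟ Y) g-Y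

        midFactors-merge-Y : ∀ W is → midFactors W j g is Y ≡ (1 , size f Y + size f X)
        midFactors-merge-Y W is rewrite isRoot-g-Y | ==-g-q Y | dec-true (Y ≟ Y) refl
          | #labelled-merge-target f (q j) (p i) X≢Y (map p (allFin n)) = refl

        lastFactors-merge-Y : ∀ is → lastFactors j g is Y ≡ 1ᵈ
        lastFactors-merge-Y is rewrite isRoot-g-Y | ==-g-q Y | dec-true (Y ≟ Y) refl = refl

        midFactors-Y : ∀ W is → midFactors W j f is Y ≡ (W * size f Y + #in f is Y , #in f is Y * size f Y)
        midFactors-Y W is rewrite isRoot-Y | dec-false (Y ≟ X) (X≢Y ∘ sym) = refl

        lastFactors-Y : ∀ is → lastFactors j f is Y ≡ (k * #in f is Y , 0)
        lastFactors-Y is rewrite isRoot-Y | dec-false (Y ≟ X) (X≢Y ∘ sym) = refl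

        midCount-join : ∀ s is → midCount s j f (i ∷ is) ≡ 1 * midCount s j g is + midCount s j f is
        midCount-join s is = begin
          K * proj₂ (∏ F₁)
            ≡⟨ cong (λ z → K * proj₂ z) (∏-split₂ F₁ F₂ X≢Y (λ v _ → midFactors-∷-other W is)) ⟩
          K * proj₂ (F₁ X ⊗ (F₁ Y ⊗ R))
            ≡⟨ cong₂ (λ a b → K * proj₂ (a ⊗ (b ⊗ R))) (midFactors-X W (i ∷ is))
                     (trans (midFactors-Y W (i ∷ is)) (cong (λ ρ → W * cY + ρ , ρ * cY) (#in-∷-Y is))) ⟩
          K * proj₂ ((1 , cX) ⊗ ((W * cY + suc ρ , suc ρ * cY) ⊗ R))
            ≡⟨ algebra K W cX cY ρ R ⟩
          1 * (K * proj₂ (1ᵈ ⊗ ((1 , cY + cX) ⊗ R))) + K * proj₂ ((1 , cX) ⊗ ((W * cY + ρ , ρ * cY) ⊗ R))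
            ≡⟨ cong₂ (λ a b → 1 * (K * proj₂ a) + K * proj₂ b)
                 (sym (trans (∏-split₂ F₃ F₂ X≢Y (λ v v≢X v≢Y → midFactors-merge-other W is v≢X v≢Y))
                             (cong₂ (λ a b → a ⊗ (b ⊗ R)) (midFactors-merge-X W is) (midFactors-merge-Y W is))))
                 (sym (trans (∏-split₂ F₂ F₂ X≢Y (λ _ _ _ → refl))
                             (cong₂ (λ a b → a ⊗ (b ⊗ R)) (midFactors-X W is) (midFactors-Y W is)))) ⟩
          1 * (K * proj₂ (∏ F₃)) + K * proj₂ (∏ F₂) ∎
          where
          open ≡-Reasoning
          W = s + k
          K = k * n ^ s
          F₁ = midFactors W j f (i ∷ is)
          F₂ = midFactors W j f is
          F₃ = midFactors W j g is
          R = ∏ (without (without F₂ X) Y)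
          cX = size f X
          cY = size f Y
          ρ = #in f is Y
          -- On the factors at X and Y: (1 + aε)(Wc + ρ + 1 + (ρ + 1)c ε) = (1 + (c + a)ε) + (1 + aε)(Wc + ρ + ρc ε).
          algebra : ∀ K W a c ρ (R : Dual) →
            K * proj₂ ((1 , a) ⊗ ((W * c + suc ρ , suc ρ * c) ⊗ R)) ≡
            1 * (K * proj₂ (1ᵈ ⊗ ((1 , c + a) ⊗ R))) + K * proj₂ ((1 , a) ⊗ ((W * c + ρ , ρ * c) ⊗ R))
          algebra K W a c ρ (r₁ , r₂) = identity K W a c ρ r₁ r₂
            where
            identity : ∀ K W a c ρ r₁ r₂ →
              K * (1 * ((W * c + (1 + ρ)) * r₂ + (1 + ρ) * c * r₁) + a * ((W * c + (1 + ρ)) * r₁)) ≡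
              1 * (K * (1 * (1 * r₂ + (c + a) * r₁) + 0 * (1 * r₁)))
                + K * (1 * ((W * c + ρ) * r₂ + ρ * c * r₁) + a * ((W * c + ρ) * r₁))
            identity = solve-∀

        lastCount-join : ∀ is → lastCount j f (i ∷ is) ≡ k * lastCount j g is + lastCount j f is
        lastCount-join is = begin
          proj₁ (∏ G₁)
            ≡⟨ cong proj₁ (∏-split₂ G₁ G₂ X≢Y (λ v _ → lastFactors-∷-other is)) ⟩
          proj₁ (G₁ X ⊗ (G₁ Y ⊗ R))
            ≡⟨ cong₂ (λ a b → proj₁ (a ⊗ (b ⊗ R))) (lastFactors-X (i ∷ is))
                     (trans (lastFactors-Y (i ∷ is)) (cong (λ ρ → k * ρ , 0) (#in-∷-Y is))) ⟩
          proj₁ (1ᵈ ⊗ ((k * suc ρ , 0) ⊗ R))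
            ≡⟨ algebra ρ R ⟩
          k * proj₁ (1ᵈ ⊗ (1ᵈ ⊗ R)) + proj₁ (1ᵈ ⊗ ((k * ρ , 0) ⊗ R))
            ≡⟨ cong₂ (λ a b → k * proj₁ a + proj₁ b)
                 (sym (trans (∏-split₂ G₃ G₂ X≢Y (λ v v≢X v≢Y → lastFactors-merge-other is v≢X v≢Y))
                             (cong₂ (λ a b → a ⊗ (b ⊗ R)) (lastFactors-merge-X is) (lastFactors-merge-Y is))))
                 (sym (trans (∏-split₂ G₂ G₂ X≢Y (λ _ _ _ → refl))
                             (cong₂ (λ a b → a ⊗ (b ⊗ R)) (lastFactors-X is) (lastFactors-Y is)))) ⟩
          k * proj₁ (∏ G₃) + proj₁ (∏ G₂) ∎
          where
          open ≡-Reasoning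
          G₁ = lastFactors j f (i ∷ is)
          G₂ = lastFactors j f is
          G₃ = lastFactors j g is
          R = ∏ (without (without G₂ X) Y)
          ρ = #in f is Y
          algebra : ∀ ρ (R : Dual) →
            proj₁ (1ᵈ ⊗ ((k * suc ρ , 0) ⊗ R)) ≡ k * proj₁ (1ᵈ ⊗ (1ᵈ ⊗ R)) + proj₁ (1ᵈ ⊗ ((k * ρ , 0) ⊗ R))
          algebra ρ (r₁ , r₂) = identity k ρ r₁
            where
            identity : ∀ k ρ r₁ → 1 * (k * (1 + ρ) * r₁) ≡ k * (1 * (1 * r₁)) + 1 * (k * ρ * r₁)
            identity = solve-∀

  completions-midStar : ∀ s j later →
    (∀ {g} → Admissible (suc (toℕ j)) g → completions later g ≡ midCount s j g []) →
    ∀ is {f} → Admissible (suc (toℕ j)) f →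
    completions (concatMap (λ i → replicate 1 (q j , p i)) is ++ later) f ≡ midCount s j f is
  completions-midStar s j later base =
    completions-star 1 (q j) p later (Admissible (suc (toℕ j))) (midCount s j) base
      (λ i is adm X≡Y → Star.Edge.midCount-∷-same j adm i X≡Y s is)
      (λ i is adm X≢Y → Star.Edge.Join.midCount-join j adm i X≢Y s is)
      (λ i adm X≢Y → Star.Edge.Join.Admissible-merge j adm i X≢Y)

  completions-lastStar : ∀ j later →
    (∀ {g} → Admissible (suc (toℕ j)) g → completions later g ≡ lastCount j g []) →
    ∀ is {f} → Admissible (suc (toℕ j)) f →
    completions (concatMap (λ i → replicate k (q j , p i)) is ++ later) f ≡ lastCount j f is
  completions-lastStar j later base =
    completions-star k (q j) p later (Admissible (suc (toℕ j))) (lastCount j) base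
      (λ i is adm X≡Y → Star.Edge.lastCount-∷-same j adm i X≡Y is)
      (λ i is adm X≢Y → Star.Edge.Join.lastCount-join j adm i X≢Y is)
      (λ i adm X≢Y → Star.Edge.Join.Admissible-merge j adm i X≢Y)

  rootWeights : Labelling (n + m) → ℕ → Vertex → Dual
  rootWeights f W v = if isRoot f v then (W * size f v , 0) else 1ᵈ

  module Opening (j : Fin m) {f : Labelling (n + m)} (adm : Admissible (toℕ j) f) (regular : ∀ v → isolated j f v ≡ false) where

    q-alone : f (q j) ≡ q j
    q-alone = untouched adm (q j) (≤-reflexive (sym (toℕ-q j)))

    p-not-with-q : ∀ v → isP v ≡ true → (v == f (q j)) ≡ false
    p-not-with-q v v∈P rewrite q-alone = dec-false (v ≟ q j) (p≢q j v∈P)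

    opening-factor : ∀ W v →
      midFactors W j f (allFin n) v ≡ (if isRoot f v then (suc W * size f v , size f v * size f v) else 1ᵈ)
    opening-factor W v with isP v in v∈P | f v ≟ v | regular v
    ... | true  | yes _ | _     rewrite p-not-with-q v v∈P = cong (_, size f v * size f v) (+-comm (W * size f v) (size f v))
    ... | true  | no _  | _     = refl
    ... | false | _     | alone rewrite alone = refl

    opening-mid : ∀ W → suc W * proj₂ (∏ (midFactors W j f (allFin n))) ≡ proj₁ (∏ (rootWeights f (suc W))) * n
    opening-mid W = begin
      suc W * proj₂ (∏ F)               ≡⟨ ∏-log-derivative (suc W) F (rootSize f) shape ⟩
      proj₁ (∏ F) * sum (rootSize f)    ≡⟨ cong₂ _*_ (proj₁-∏-cong F (rootWeights f (suc W)) values) (sum-rootSize adm) ⟩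
      proj₁ (∏ (rootWeights f (suc W))) * n ∎
      where
      open ≡-Reasoning
      F = midFactors W j f (allFin n)
      shape : ∀ v → F v ≡ (suc W * rootSize f v , rootSize f v * rootSize f v) ⊎ (F v ≡ 1ᵈ × rootSize f v ≡ 0)
      shape v rewrite opening-factor W v with isRoot f v
      ... | true  = inj₁ refl
      ... | false = inj₂ (refl , refl)
      values : ∀ v → proj₁ (F v) ≡ proj₁ (rootWeights f (suc W) v)
      values v rewrite opening-factor W v with isRoot f v
      ... | true  = refl
      ... | false = refl

    opening-last : lastFactors j f (allFin n) ≗ rootWeights f k
    opening-last v with isP v in v∈P | f v ≟ v | regular v
    ... | true  | yes _ | _     rewrite p-not-with-q v v∈P = refl
    ... | true  | no _  | _     = refl
    ... | false | _     | alone rewrite alone = refl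

  module Boundary (j j′ : Fin m) (next : toℕ j′ ≡ suc (toℕ j)) {f : Labelling (n + m)} (adm : Admissible (suc (toℕ j)) f) where

    open Star j adm using (X; X-alone-or-p; midFactors-X)

    isolated-next : ∀ v → v ≢ q j → isolated j′ f v ≡ isolated j f v
    isolated-next v v≢q
      rewrite next | +-suc n (toℕ j) | <?-suc {toℕ v} (λ eq → v≢q (toℕ-injective (trans eq (sym (toℕ-q j))))) = refl

    isolated-next-q : isolated j′ f (q j) ≡ (X == q j)
    isolated-next-q rewrite isP-q j | toℕ-q j | next | +-suc n (toℕ j)
      | dec-true (n + toℕ j <? suc (n + toℕ j)) ≤-refl = ∧-identityʳ _

    Regular : Set
    Regular = ∀ v → isolated j′ f v ≡ false

    adm′ : Admissible (toℕ j′) f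
    adm′ = subst (λ t → Admissible t f) (sym next) adm

    regular-or-degenerate : Regular ⊎ ∃ λ w → isolated j′ f w ≡ true
    regular-or-degenerate with any? (λ w → isolated j′ f w Data.Bool.≟ true)
    ... | yes found = inj₂ found
    ... | no  none  = inj₁ λ v → ¬-not λ iso → none (v , iso)

    Regular⇒X∈P : Regular → isP X ≡ true
    Regular⇒X∈P regular with X-alone-or-p
    ... | inj₁ X≡q = ⊥-elim (true≢false (trans (sym (dec-true (X ≟ q j) X≡q)) (trans (sym isolated-next-q) (regular (q j)))))
    ... | inj₂ X∈P = X∈P

    Regular⇒no-isolated : Regular → ∀ v → isolated j f v ≡ false
    Regular⇒no-isolated regular v with v ≟ q j
    ... | yes refl = isolated-q j f
    ... | no v≢q   = trans (sym (isolated-next v v≢q)) (regular v)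

    closing : Regular → ∀ W → W * proj₂ (∏ (midFactors W j f [])) ≡ proj₁ (∏ (rootWeights f W))
    closing regular W = begin
      W * proj₂ (∏ F)                         ≡⟨ cong (λ z → W * proj₂ z) (∏-extract F X) ⟩
      W * proj₂ (F X ⊗ ∏ (without F X))       ≡⟨ cong₂ (λ a b → W * proj₂ (a ⊗ b)) (midFactors-X W []) (∏-cong agree) ⟩
      W * proj₂ ((1 , size f X) ⊗ R)          ≡⟨ ε-free R (proj₂-∏-zero (without A X) flat) ⟩
      proj₁ ((W * size f X , 0) ⊗ R)          ≡⟨ cong (λ a → proj₁ (a ⊗ R)) A-X ⟨
      proj₁ (A X ⊗ R)                         ≡⟨ cong proj₁ (∏-extract A X) ⟨
      proj₁ (∏ A)                             ∎
      where
      open ≡-Reasoning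
      F = midFactors W j f []
      A = rootWeights f W
      R = ∏ (without A X)
      A-X : A X ≡ (W * size f X , 0)
      A-X rewrite Regular⇒X∈P regular | dec-true (f X ≟ X) (idempotent adm (q j)) = refl
      agree : ∀ v → without F X v ≡ without A X v
      agree v with v ≟ X
      ... | yes _ = refl
      ... | no _ with isRoot f v | Regular⇒no-isolated regular v
      ...   | true  | _    = cong (_, 0) (+-identityʳ _)
      ...   | false | none rewrite none = refl
      flat : ∀ v → proj₂ (without A X v) ≡ 0
      flat v with v == X | isRoot f v
      ... | true  | _     = refl
      ... | false | true  = refl
      ... | false | false = refl
      ε-free : ∀ R → proj₂ R ≡ 0 → W * proj₂ ((1 , size f X) ⊗ R) ≡ proj₁ ((W * size f X , 0) ⊗ R)
      ε-free (r , .0) refl = identity W (size f X) r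
        where
        identity : ∀ W c r → W * (1 * 0 + c * r) ≡ W * c * r
        identity = solve-∀

    degenerate-start : ∀ w → isolated j′ f w ≡ true → ∀ W → proj₂ (∏ (midFactors W j′ f (allFin n))) ≡ 0
    degenerate-start w iso W = cong proj₂ (∏-absorbing _ w (midFactors-isolated W j′ f (allFin n) w iso))

    degenerate-end : ∀ w → isolated j′ f w ≡ true → ∀ W → proj₂ (∏ (midFactors W j f [])) ≡ 0
    degenerate-end w iso W with w ≟ q j
    ... | no w≢q = cong proj₂ (∏-absorbing _ w (midFactors-isolated W j f [] w (trans (sym (isolated-next w w≢q)) iso)))
    ... | yes refl = proj₂-∏-zero _ flat
      where
      X≡q : X ≡ q j
      X≡q = ==⇒≡ (trans (sym isolated-next-q) iso)
      flat : ∀ v → proj₂ (midFactors W j f [] v) ≡ 0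
      flat v with isP v in v∈P | f v ≟ v | isolated j f v
      ... | true  | yes _ | _ rewrite X≡q | dec-false (v ≟ q j) (p≢q j v∈P) = refl
      ... | true  | no _  | true  = refl
      ... | true  | no _  | false = refl
      ... | false | _     | true  = refl
      ... | false | _     | false = refl

    boundary-mid : ∀ s → midCount s j′ f (allFin n) ≡ midCount (suc s) j f []
    boundary-mid s with regular-or-degenerate
    ... | inj₂ (w , iso) = begin
      k * n ^ s * proj₂ (∏ (midFactors (s + k) j′ f (allFin n))) ≡⟨ cong (k * n ^ s *_) (degenerate-start w iso (s + k)) ⟩
      k * n ^ s * 0                                              ≡⟨ *-zeroʳ (k * n ^ s) ⟩
      0                                                          ≡⟨ *-zeroʳ (k * n ^ suc s) ⟨
      k * n ^ suc s * 0                                          ≡⟨ cong (k * n ^ suc s *_) (degenerate-end w iso (suc s + k)) ⟨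
      k * n ^ suc s * proj₂ (∏ (midFactors (suc s + k) j f []))  ∎
      where open ≡-Reasoning
    ... | inj₁ regular = *-cancelˡ-≡ _ _ (suc (s + k)) (begin
      suc W * (k * n ^ s * proj₂ (∏ F′))   ≡⟨ swap (suc W) (k * n ^ s) _ ⟩
      k * n ^ s * (suc W * proj₂ (∏ F′))   ≡⟨ cong (k * n ^ s *_) (Opening.opening-mid j′ adm′ regular W) ⟩
      k * n ^ s * (P * n)                   ≡⟨ regroup k (n ^ s) P n ⟩
      k * n ^ suc s * P                     ≡⟨ cong (k * n ^ suc s *_) (closing regular (suc W)) ⟨
      k * n ^ suc s * (suc W * proj₂ (∏ F)) ≡⟨ swap (k * n ^ suc s) (suc W) _ ⟩
      suc W * (k * n ^ suc s * proj₂ (∏ F)) ∎)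
      where
      open ≡-Reasoning
      W = s + k
      F′ = midFactors W j′ f (allFin n)
      F = midFactors (suc W) j f []
      P = proj₁ (∏ (rootWeights f (suc W)))
      swap : ∀ a b c → a * (b * c) ≡ b * (a * c)
      swap = solve-∀
      regroup : ∀ k x P n → k * x * (P * n) ≡ k * (n * x) * P
      regroup = solve-∀

    boundary-last : lastCount j′ f (allFin n) ≡ midCount 0 j f []
    boundary-last with regular-or-degenerate
    ... | inj₂ (w , iso) = trans (cong proj₁ (∏-absorbing _ w (lastFactors-isolated j′ f (allFin n) w iso)))
                          (sym (trans (cong (k * 1 *_) (degenerate-end w iso k)) (*-zeroʳ (k * 1))))
    ... | inj₁ regular = begin
      proj₁ (∏ (lastFactors j′ f (allFin n)))   ≡⟨ cong proj₁ (∏-cong (Opening.opening-last j′ adm′ regular)) ⟩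
      proj₁ (∏ (rootWeights f k))                 ≡⟨ closing regular k ⟨
      k * proj₂ (∏ (midFactors k j f []))       ≡⟨ cong (_* proj₂ (∏ (midFactors k j f []))) (*-identityʳ k) ⟨
      k * 1 * proj₂ (∏ (midFactors k j f []))   ∎
      where open ≡-Reasoning

  isRoot⇒fixed : ∀ {f v} → isRoot f v ≡ true → f v ≡ v
  isRoot⇒fixed {f} {v} root = ==⇒≡ (∧-conicalʳ (isP v) _ root)

  isolated⇒fixed : ∀ {j f v} → isolated j f v ≡ true → f v ≡ v
  isolated⇒fixed {j} {f} {v} iso = ==⇒≡ (∧-conicalˡ (f v == v) _ (∧-conicalʳ (not (isP v)) _ iso))

  -- After the last star, a class other than that of q_j, or an isolated q, rules out every completion.
  stray : Fin m → Labelling (n + m) → Vertex → Bool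
  stray j f v = if isRoot f v then not (v == f (q j)) else isolated j f v

  lastFactor-stray : ∀ r x i → (if r then not x else i) ≡ true → proj₁ (lastFactor r x 0 i) ≡ 0
  lastFactor-stray true  false _    _ = *-zeroʳ k
  lastFactor-stray false _     true _ = refl

  lastFactor-not-stray : ∀ r x i → (if r then not x else i) ≡ false → lastFactor r x 0 i ≡ 1ᵈ
  lastFactor-not-stray true  true  _     _ = refl
  lastFactor-not-stray false _     false _ = refl

  module End (j : Fin m) (last : suc (toℕ j) ≡ m) {f : Labelling (n + m)} (adm : Admissible (suc (toℕ j)) f) where

    X = f (q j)

    stray⇒not-constant : Fin n → ∀ v → stray j f v ≡ true → allEqualB f ≡ false
    stray⇒not-constant i₀ v h with isRoot f v in root
    ... | true  = allEqualB-≢ f {v} {q j} λ fv≡X → true≢false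
                    (trans (sym h) (cong not (dec-true (v ≟ X) (trans (sym (isRoot⇒fixed {f} root)) fv≡X))))
    ... | false = allEqualB-≢ f {p i₀} {v} λ fp≡fv → true≢false (trans (sym (p-named-by-p adm i₀))
                    (trans (cong isP (trans fp≡fv (isolated⇒fixed {j} {f} h))) (isolated⇒non-p j f v h)))

    no-stray⇒constant : (∀ v → stray j f v ≡ false) → allEqualB f ≡ true
    no-stray⇒constant none = allEqualB-const f X λ u → in-X (f u) (idempotent adm u)
      where
      in-X : ∀ w → f w ≡ w → w ≡ X
      in-X w fw with isP w | none w
      ... | true  | h rewrite dec-true (f w ≟ w) fw = sym (==⇒≡ (trans (==-sym X w) (not-injective h)))
      ... | false | h rewrite dec-true (f w ≟ w) fw = sym (trans (cong f (sym w≡q)) fw)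
        where
        w≡q : w ≡ q j
        w≡q = toℕ-injective (trans (≤-antisym
          (s≤s⁻¹ (subst (toℕ w <_) (trans (cong (n +_) (sym last)) (+-suc n (toℕ j))) (toℕ<n w)))
          (≮⇒≥ (λ lt → true≢false (trans (sym (dec-true (toℕ w <? n + toℕ j) lt)) h)))) (sym (toℕ-q j)))

    completions-end : Fin n → completions [] f ≡ lastCount j f []
    completions-end i₀ with any? (λ v → stray j f v Data.Bool.≟ true)
    ... | yes (v , h) rewrite stray⇒not-constant i₀ v h =
      sym (proj₁-∏-zero (lastFactors j f []) v (lastFactor-stray (isRoot f v) (v == X) (isolated j f v) h))
    ... | no none = trans (cong (λ b → if b then 1 else 0) (no-stray⇒constant regular))
      (sym (cong proj₁ (∏-one (lastFactors j f []) λ v → lastFactor-not-stray (isRoot f v) (v == X) (isolated j f v) (regular v))))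
      where
      regular : ∀ v → stray j f v ≡ false
      regular v = ¬-not (λ h → none (v , h))

  multiplicity : Fin m → ℕ
  multiplicity j = if suc (toℕ j) ≡ᵇ m then k else 1

  star : Fin m → Multigraph (n + m)
  star j = concatMap (λ i → replicate (multiplicity j) (q j , p i)) (allFin n)

  startCount : ℕ → Fin m → Labelling (n + m) → ℕ
  startCount zero    j f = lastCount j f (allFin n)
  startCount (suc s) j f = midCount s j f (allFin n)

  startCount-boundary : ∀ s (j j′ : Fin m) → toℕ j′ ≡ suc (toℕ j) → ∀ {f} → Admissible (suc (toℕ j)) f →
    startCount s j′ f ≡ midCount s j f []
  startCount-boundary zero    j j′ next adm = Boundary.boundary-last j j′ next adm
  startCount-boundary (suc s) j j′ next adm = Boundary.boundary-mid j j′ next adm s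

  completions-stars : Fin n → ∀ s (j : Fin m) → toℕ j + suc s ≡ m → ∀ {f} → Admissible (toℕ j) f →
    completions (concatMap star (drop (toℕ j) (allFin m))) f ≡ startCount s j f
  completions-stars i₀ zero j j+1≡m adm
    with last ← trans (+-comm 1 (toℕ j)) j+1≡m
    rewrite drop-tabulate (λ x → x) j
          | drop-all (suc (toℕ j)) (allFin m) (≤-reflexive (trans (length-tabulate (λ x → x)) (sym last)))
          | dec-true (suc (toℕ j) Data.Nat.≟ m) last
    = completions-lastStar j [] (λ adm′ → End.completions-end j last adm′ i₀) (allFin n) (Admissible-suc adm)
  completions-stars i₀ (suc s) j j+s+2≡m {f} adm
    with j+1<m ← subst (suc (toℕ j) <_) j+s+2≡m
                   (subst (suc (suc (toℕ j)) ≤_) (sym (trans (+-suc (toℕ j) (suc s)) (cong suc (+-suc (toℕ j) s))))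
                          (s≤s (s≤s (m≤m+n (toℕ j) s))))
    rewrite drop-tabulate (λ x → x) j | dec-false (suc (toℕ j) Data.Nat.≟ m) (λ eq → <-irrefl eq j+1<m)
    = completions-midStar s j _ later (allFin n) (Admissible-suc adm)
    where
    j′ = fromℕ< j+1<m
    next : toℕ j′ ≡ suc (toℕ j)
    next = toℕ-fromℕ< j+1<m
    later : ∀ {g} → Admissible (suc (toℕ j)) g →
      completions (concatMap star (drop (suc (toℕ j)) (allFin m))) g ≡ midCount s j g []
    later {g} adm′ = trans
      (subst (λ t → completions (concatMap star (drop t (allFin m))) g ≡ startCount s j′ g) next
        (completions-stars i₀ s j′ (trans (cong (_+ suc s) next) (trans (sym (+-suc (toℕ j) (suc s))) j+s+2≡m))
          (subst (λ t → Admissible t g) (sym next) adm′)))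
      (startCount-boundary s j j′ next adm′)

  Admissible-id : Admissible 0 (λ v → v)
  Admissible-id = record
    { idempotent = λ _ → refl
    ; p-named-by-p = isP-p
    ; q-alone-or-named-by-p = λ _ _ → inj₁ refl
    ; untouched = λ _ _ → refl
    }

  module Initial (j₀ : Fin m) (first : toℕ j₀ ≡ 0) where

    regular : ∀ v → isolated j₀ (λ v → v) v ≡ false
    regular v rewrite first | +-identityʳ n with isP v
    ... | true  = refl
    ... | false = ∧-zeroʳ _

    size-id : ∀ v → isP v ≡ true → size (λ v → v) v ≡ 1
    size-id v v∈P = begin
      countᵇ (λ u → u == v) (map p (allFin n))         ≡⟨ countᵇ-map (λ u → u == v) p (allFin n) ⟩
      countᵇ (λ i → p i == v) (allFin n)               ≡⟨ countᵇ-tabulate (λ i → p i == v) (λ i → i) ⟩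
      sum (λ i → if p i == v then 1 else 0)            ≡⟨ sum-cong-≗ (λ i → cong (λ b → if b then 1 else 0) (at i)) ⟩
      sum (λ i → if i′ == i then 1 else 0)             ≡⟨ sum-δ i′ ⟩
      1                                                ∎
      where
      open ≡-Reasoning
      i′ = fromℕ< (isP-true v∈P)
      p-i′ : p i′ ≡ v
      p-i′ = toℕ-injective (trans (toℕ-↑ˡ i′ m) (toℕ-fromℕ< (isP-true v∈P)))
      at : ∀ i → (p i == v) ≡ (i′ == i)
      at i = bool-ext (λ e → dec-true (i′ ≟ i) (↑ˡ-injective m i′ i (trans p-i′ (sym (==⇒≡ e)))))
                      (λ e → dec-true (p i ≟ v) (trans (cong p (sym (==⇒≡ e))) p-i′))

    rootWeights-id : ∀ W → proj₁ (∏ (rootWeights (λ v → v) W)) ≡ W ^ n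
    rootWeights-id W = proj₁-∏-prefix W n (rootWeights (λ v → v) W) weight
      where
      weight : ∀ v → proj₁ (rootWeights (λ v → v) W v) ≡ (if isP v then W else 1)
      weight v with isP v in v∈P
      ... | true  rewrite dec-true (v ≟ v) refl | size-id v v∈P = *-identityʳ W
      ... | false = refl

    open Opening j₀ (subst (λ t → Admissible t (λ v → v)) (sym first) Admissible-id) regular

    startCount-initial : ∀ n′ → n ≡ suc n′ → ∀ s → startCount s j₀ (λ v → v) ≡ k * n ^ s * (s + k) ^ n′
    startCount-initial n′ refl zero = begin
      proj₁ (∏ (lastFactors j₀ (λ v → v) (allFin n)))  ≡⟨ cong proj₁ (∏-cong opening-last) ⟩
      proj₁ (∏ (rootWeights (λ v → v) k))              ≡⟨ rootWeights-id k ⟩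
      k * k ^ n′                                       ≡⟨ cong (_* k ^ n′) (*-identityʳ k) ⟨
      k * 1 * k ^ n′                                   ∎
      where open ≡-Reasoning
    startCount-initial n′ refl (suc s) = begin
      k * n ^ s * D              ≡⟨ cong (k * n ^ s *_) (*-cancelˡ-≡ D (Y ^ n′ * n) Y YD) ⟩
      k * n ^ s * (Y ^ n′ * n)   ≡⟨ regroup k (n ^ s) (Y ^ n′) n ⟩
      k * n ^ suc s * Y ^ n′     ∎
      where
      open ≡-Reasoning
      W = s + k
      Y = suc W
      D = proj₂ (∏ (midFactors W j₀ (λ v → v) (allFin n)))
      YD : Y * D ≡ Y * (Y ^ n′ * n)
      YD = trans (opening-mid W) (trans (cong (_* n) (rootWeights-id Y)) (*-assoc Y (Y ^ n′) n))
      regroup : ∀ k x y n → k * x * (y * n) ≡ k * (n * x) * y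
      regroup = solve-∀

theorem3p1 : (m n k : ℕ) → m ≥ 1 → n ≥ 1 → k ≥ 1 →
    t (MkKmn m n k) ≡ k * n ^ (m ∸ 1) * (m + k ∸ 1) ^ (n ∸ 1)
theorem3p1 (suc m′) (suc n′) k _ _ _ = begin
  t (MkKmn (suc m′) (suc n′) k)                            ≡⟨ t≡completions (MkKmn (suc m′) (suc n′) k) ⟩
  completions (concatMap star (allFin (suc m′))) (λ v → v) ≡⟨ completions-stars zero m′ zero refl Admissible-id ⟩
  startCount m′ zero (λ v → v)                             ≡⟨ Initial.startCount-initial zero refl n′ refl m′ ⟩
  k * suc n′ ^ m′ * (m′ + k) ^ n′                          ∎
  where
  open ≡-Reasoning
  open Count (suc m′) (suc n′) k
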